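{- Let $m,M$ be integers with $M>1$. Then: \begin{enumerate} \item If $M=p^t$ is a power of an odd prime $p$ (with $t\ge1$), then $\mathcal{A}_{2,m,M,1,1}>0$ if and only if $m\equiv\pm1\pmod p$. \item If $6\mid M$, then $\mathcal{A}_{2,m,M,1,1}<0$ if and only if $\gcd(m-1,M)=1$ or $\gcd(m+1,M)=1$. \item $\displaystyle\liminf_{X\to\infty}\frac{|\{(m,M):1\le m\le M\le X,\ \mathcal{A}_{2,m,M,1,1}>0\}|}{|\{(m,M):1\le m\le M\le X\}|}\ge\frac14$ and $\displaystyle\liminf_{X\to\infty}\frac{|\{(m,M):1\le m\le M\le X,\ \mathcal{A}_{2,m,M,1,1}<0\}|}{|\{(m,M):1\le m\le M\le X\}|}\ge\frac{1}{2\pi^2}$. \end{enumerate}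
   Context: For integers $M\ge1$, $m$, the bias $\mathcal{A}_{2,m,M,1,1}$ (the average over primes of the size-$p$ term in the expansion of the second moment $\sum_{E/\mathbb{F}_p,\,\mathrm{tr}(E)\equiv m\,(M)}\mathrm{tr}(E)^2/|\mathrm{Aut}(E)|$ of traces of Frobenius) is given by $$\mathcal{A}_{2,m,M,1,1}=\frac{1}{2\phi(M)}\Bigg(2\prod_{q\mid M}\frac{1-\delta_{q\nmid m}/(q^2-q)}{1+1/q}-\delta_{\gcd(m-1,M)=1}-\delta_{\gcd(m+1,M)=1}\Bigg),$$ the product over primes $q\mid M$, where $\delta_S=1$ if $S$ holds and $0$ otherwise, and $\phi$ is Euler's totient function. -}

module Defs where

open import Data.Bool using (Bool; true; false; if_then_else_)
open import Data.Nat as ℕ using (ℕ; zero; suc)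
open import Data.Nat.Divisibility using (_∣?_)
open import Data.Nat.GCD using (gcd)
open import Data.Nat.Primality using (prime?)
open import Data.Integer as ℤ using (ℤ; +_; -[1+_]; ∣_∣)
open import Data.Rational using (ℚ; _/_; 0ℚ; 1ℚ; _+_; _*_; _-_; _<_)
open import Data.Rational.Properties using (_<?_)
open import Data.List using (List; []; _∷_; map; filter; upTo; length; foldr)
open import Relation.Nullary using (does; ¬?)
open import Relation.Nullary.Decidable using (_×-dec_)
open import Relation.Binary.PropositionalEquality using (_≡_)

ι : ℤ → ℚ
ι a = a / 1

-- 1/n for n ≥ 1 (and 0 for n = 0; only used with n ≥ 1)
inv : ℕ → ℚ
inv zero    = 0ℚ
inv (suc n) = + 1 / suc n

δ : Bool → ℚ
δ true  = 1ℚ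
δ false = 0ℚ

oneTo : ℕ → List ℕ
oneTo n = map suc (upTo n)

φ : ℕ → ℕ
φ n = length (filter (λ k → gcd k n ℕ.≟ 1) (oneTo n))

primeDivisors : ℕ → List ℕ
primeDivisors M = filter (λ q → prime? q ×-dec (q ∣? M)) (upTo (suc M))

-- factor (1 - δ_{q ∤ m}/(q^2 - q)) / (1 + 1/q)
localFactor : ℤ → ℕ → ℚ
localFactor m q =
  (1ℚ - δ (does (¬? (q ∣? ∣ m ∣))) * inv (q ℕ.* q ℕ.∸ q)) * (+ q / suc q)

bias : ℤ → ℕ → ℚ
bias m M =
  inv (2 ℕ.* φ M) *
    ( ι (+ 2) * foldr (λ q r → localFactor m q * r) 1ℚ (primeDivisors M)
      - δ (does (gcd (∣ m ℤ.- + 1 ∣) M ℕ.≟ 1))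
      - δ (does (gcd (∣ m ℤ.+ + 1 ∣) M ℕ.≟ 1)) )

countPairs : (ℕ → ℕ → Bool) → ℕ → ℕ
countPairs P X =
  foldr ℕ._+_ 0 (map (λ M → length (filter (λ m → Data.Bool._≟_ (P m M) true) (oneTo M))) (oneTo X))
  where import Data.Bool

posCount : ℕ → ℕ
posCount = countPairs (λ m M → does (0ℚ <? bias (+ m) M))

negCount : ℕ → ℕ
negCount = countPairs (λ m M → does (bias (+ m) M <? 0ℚ))

totalCount : ℕ → ℕ
totalCount = countPairs (λ _ _ → true)

-- Leibniz partial sums  L n = 4 Σ_{k<n} (-1)^k / (2k+1), which converge to π;
-- the odd-index ones L(2K+1) decrease strictly to π.
leibniz : ℕ → ℚ
leibniz zero    = 0ℚ
leibniz (suc n) = leibniz n + ι (sgn n) * (+ 4 / suc (2 ℕ.* n))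
  where
  sgn : ℕ → ℤ
  sgn zero          = + 1
  sgn (suc zero)    = -[1+ 0 ]
  sgn (suc (suc k)) = sgn k

-- b > π  (rational upper bound for π)
AbovePi : ℚ → Set
AbovePi b = Data.Product.∃ λ K → leibniz (suc (2 ℕ.* K)) < b
  where import Data.Product

-- q < 1/(2π²)  ⇔  ∃ rational b > π with 2 q b² < 1
BelowInvTwoPiSq : ℚ → Set
BelowInvTwoPiSq q = Data.Product.∃ λ b → Data.Product._×_ (AbovePi b) (ι (+ 2) * q * b * b < 1ℚ)
  where import Data.Product

{-# OPTIONS --safe #-}
module Submission where

-- Write a = |m - 1|, c = |m|, b = |m + 1| and P = ∏_{q ∣ M} F(q), where the local
-- factor F(q) = (1 - δ_{q ∤ c}/(q² - q)) q/(q + 1) lies in (0, 1) for every prime q.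
-- Since 2φ(M)·𝒜 = 2P - δ_a - δ_b, the bias is positive when neither a nor b is
-- coprime to M, negative when both are (and M > 1), and has the sign of 2P - 1
-- otherwise.  For M = p^t with p odd, P = F(p), and p divides at most one of the
-- neighbours a, c, b; if p ∤ c then F(p) ≥ F(3) = 5/8 > 1/2.  If 6 ∣ M and only a is
-- coprime to M, then 2 ∣ c, and either 3 ∤ c and P ≤ F(2)F(3) = 5/12, or 3 ∣ c and b
-- has a prime factor r ∤ 6 dividing M, so that P ≤ F(2)F(3)F(r) = F(r)/2 < 1/2.
--
-- Among the pairs 1 ≤ m ≤ M ≤ X, those with M and m - 1 even have positive bias and
-- make up about a quarter of all pairs.  A pair with M > 1 whose bias is not negative
-- has a common divisor d of M and of m - 1 or m + 1 with d = 2 or d = 2l + 3, and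
-- for each such d and residue there are at most T(X/d) such pairs (T the triangular
-- numbers).  As ∑_l 1/(2l + 3)² ≤ 1/4, these are at most 3/4 of all pairs up to
-- lower order terms, so at least 1/18 of the pairs have negative bias; and
-- 1/18 > 1/(2π²) because the odd partial sums of the Leibniz series, which decrease
-- to π, are all at least 3.

module RationalArithmetic where

  open import Data.Nat as ℕ using (ℕ; suc)
  import Data.Nat.Properties as ℕ
  open import Data.Integer as ℤ using (+_)
  import Data.Integer.Properties as ℤ
  open import Data.Rational
    using (ℚ; _/_; 0ℚ; 1ℚ; _+_; _*_; _-_; -_; _≤_; _<_; toℚᵘ; positive; nonNegative)
  open import Data.Rational.Properties
  import Data.Rational.Unnormalised as ℚᵘ
  import Data.Rational.Unnormalised.Properties as ℚᵘ
  open import Function.Bundles using (_⇔_; mk⇔)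
  open import Relation.Binary.PropositionalEquality
  import Data.Rational.Solver as ℚ-Solver
  import Data.Integer.Solver as ℤ-Solver

  private
    toℚᵘ-/ : ∀ a b → toℚᵘ (+ a / suc b) ℚᵘ.≃ ℚᵘ.mkℚᵘ (+ a) b
    toℚᵘ-/ a b = toℚᵘ-fromℚᵘ (ℚᵘ.mkℚᵘ (+ a) b)

  cross-≤ : ∀ a b c d .{{_ : ℕ.NonZero b}} .{{_ : ℕ.NonZero d}} → a ℕ.* d ℕ.≤ c ℕ.* b → + a / b ≤ + c / d
  cross-≤ a (suc b) c (suc d) h = toℚᵘ-cancel-≤
    (ℚᵘ.≤-respˡ-≃ (ℚᵘ.≃-sym (toℚᵘ-/ a b)) (ℚᵘ.≤-respʳ-≃ (ℚᵘ.≃-sym (toℚᵘ-/ c d))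
      (ℚᵘ.*≤* (subst₂ ℤ._≤_ (ℤ.pos-* a (suc d)) (ℤ.pos-* c (suc b)) (ℤ.+≤+ h)))))

  cross-< : ∀ a b c d .{{_ : ℕ.NonZero b}} .{{_ : ℕ.NonZero d}} → a ℕ.* d ℕ.< c ℕ.* b → + a / b < + c / d
  cross-< a (suc b) c (suc d) h = toℚᵘ-cancel-<
    (ℚᵘ.<-respˡ-≃ (ℚᵘ.≃-sym (toℚᵘ-/ a b)) (ℚᵘ.<-respʳ-≃ (ℚᵘ.≃-sym (toℚᵘ-/ c d))
      (ℚᵘ.*<* (subst₂ ℤ._<_ (ℤ.pos-* a (suc d)) (ℤ.pos-* c (suc b)) (ℤ.+<+ h)))))

  cross-≡ : ∀ a b c d .{{_ : ℕ.NonZero b}} .{{_ : ℕ.NonZero d}} → a ℕ.* d ≡ c ℕ.* b → + a / b ≡ + c / d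
  cross-≡ a b c d h = ≤-antisym (cross-≤ a b c d (ℕ.≤-reflexive h)) (cross-≤ c d a b (ℕ.≤-reflexive (sym h)))

  /-* : ∀ a b c d .{{_ : ℕ.NonZero b}} .{{_ : ℕ.NonZero d}} →
        (+ a / b) * (+ c / d) ≡ (+ (a ℕ.* c) / (b ℕ.* d)) {{ℕ.m*n≢0 b d}}
  /-* a (suc b) c (suc d) = toℚᵘ-injective (ℚᵘ.≃-trans (toℚᵘ-homo-* (+ a / suc b) (+ c / suc d))
    (ℚᵘ.≃-trans (ℚᵘ.*-cong (toℚᵘ-/ a b) (toℚᵘ-/ c d))
    (ℚᵘ.≃-trans (ℚᵘ.≃-reflexive (cong (λ n → ℚᵘ.mkℚᵘ n (d ℕ.+ b ℕ.* suc d)) (sym (ℤ.pos-* a c))))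
    (ℚᵘ.≃-sym (toℚᵘ-/ (a ℕ.* c) (d ℕ.+ b ℕ.* suc d))))))

  /-+ : ∀ a c b .{{_ : ℕ.NonZero b}} → (+ a / b) + (+ c / b) ≡ + (a ℕ.+ c) / b
  /-+ a c (suc b) = toℚᵘ-injective (ℚᵘ.≃-trans (toℚᵘ-homo-+ (+ a / suc b) (+ c / suc b))
    (ℚᵘ.≃-trans (ℚᵘ.+-cong (toℚᵘ-/ a b) (toℚᵘ-/ c b)) (ℚᵘ.≃-trans (ℚᵘ.*≡* cross) (ℚᵘ.≃-sym (toℚᵘ-/ (a ℕ.+ c) b)))))
    where
    open ℤ-Solver.+-*-Solver
    B = suc b
    cross : (+ a ℤ.* + B ℤ.+ + c ℤ.* + B) ℤ.* + B ≡ + (a ℕ.+ c) ℤ.* + (B ℕ.* B)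
    cross = trans (solve 3 (λ a c B → (a :* B :+ c :* B) :* B := (a :+ c) :* (B :* B)) refl (+ a) (+ c) (+ B))
      (cong₂ ℤ._*_ (sym (ℤ.pos-+ a c)) (sym (ℤ.pos-* B B)))

  0≤a/b : ∀ a b .{{_ : ℕ.NonZero b}} → 0ℚ ≤ + a / b
  0≤a/b a b = cross-≤ 0 1 a b ℕ.z≤n

  0<a/b : ∀ a b .{{_ : ℕ.NonZero a}} .{{_ : ℕ.NonZero b}} → 0ℚ < + a / b
  0<a/b (suc a) b = cross-< 0 1 (suc a) b (ℕ.s≤s ℕ.z≤n)

  *-pos : ∀ {p q} → 0ℚ < p → 0ℚ < q → 0ℚ < p * q
  *-pos {p} {q} 0<p 0<q = positive⁻¹ (p * q) {{pos*pos⇒pos p {{positive 0<p}} q {{positive 0<q}}}}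

  p≤1⇒p*q≤q : ∀ {p q} → p ≤ 1ℚ → 0ℚ ≤ q → p * q ≤ q
  p≤1⇒p*q≤q {p} {q} p≤1 0≤q = ≤-trans (*-monoʳ-≤-nonNeg q {{nonNegative 0≤q}} p≤1) (≤-reflexive (*-identityˡ q))

  *-mono-≤-nonNeg : ∀ {p q r s} → 0ℚ ≤ p → 0ℚ ≤ s → p ≤ q → r ≤ s → p * r ≤ q * s
  *-mono-≤-nonNeg {p} {q} {r} {s} 0≤p 0≤s p≤q r≤s =
    ≤-trans (*-monoˡ-≤-nonNeg p {{nonNegative 0≤p}} r≤s) (*-monoʳ-≤-nonNeg s {{nonNegative 0≤s}} p≤q)

  0<w*x⇔0<x : ∀ {w x} → 0ℚ < w → (0ℚ < w * x ⇔ 0ℚ < x)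
  0<w*x⇔0<x {w} {x} 0<w = mk⇔
    (λ 0<wx → *-cancelˡ-<-nonNeg w {{pos⇒nonNeg w {{positive 0<w}}}} (subst (_< w * x) (sym (*-zeroʳ w)) 0<wx))
    (*-pos 0<w)

  w*x<0⇔x<0 : ∀ {w x} → 0ℚ < w → (w * x < 0ℚ ⇔ x < 0ℚ)
  w*x<0⇔x<0 {w} {x} 0<w = mk⇔
    (λ wx<0 → *-cancelˡ-<-nonNeg w {{pos⇒nonNeg w {{positive 0<w}}}} (subst (w * x <_) (sym (*-zeroʳ w)) wx<0))
    (λ x<0 → subst (w * x <_) (*-zeroʳ w) (*-monoʳ-<-pos w {{positive 0<w}} x<0))

  private
    q-p+p≡q : ∀ p q → q - p + p ≡ q
    q-p+p≡q p q = solve 2 (λ p q → (q :- p) :+ p := q) refl p q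
      where open ℚ-Solver.+-*-Solver

  0<q-p⇔p<q : ∀ {p q} → 0ℚ < q - p ⇔ p < q
  0<q-p⇔p<q {p} {q} = mk⇔
    (λ h → subst₂ _<_ (+-identityˡ p) (q-p+p≡q p q) (+-monoˡ-< p h))
    (λ h → subst (_< q - p) (+-inverseʳ p) (+-monoˡ-< (- p) h))

  q-p<0⇔q<p : ∀ {p q} → q - p < 0ℚ ⇔ q < p
  q-p<0⇔q<p {p} {q} = mk⇔
    (λ h → subst₂ _<_ (q-p+p≡q p q) (+-identityˡ p) (+-monoˡ-< p h))
    (λ h → subst (q - p <_) (+-inverseʳ p) (+-monoˡ-< (- p) h))

  p≤q⇒0≤q-p : ∀ {p q} → p ≤ q → 0ℚ ≤ q - p
  p≤q⇒0≤q-p {p} {q} h = subst (_≤ q - p) (+-inverseʳ p) (+-monoˡ-≤ (- p) h)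

module ListProducts where

  open import Data.List using (List; []; _∷_; _++_; foldr)
  open import Data.List.Membership.Propositional using (_∈_)
  open import Data.List.Membership.Propositional.Properties using (∈-∃++; ∈-++⁺ˡ; ∈-++⁺ʳ; ∈-++⁻)
  open import Data.List.Relation.Unary.All as All using ()
  open import Data.List.Relation.Unary.AllPairs using ([]; _∷_)
  open import Data.List.Relation.Unary.Any using (here; there)
  open import Data.List.Relation.Unary.Unique.Propositional using (Unique)
  open import Data.List.Relation.Binary.Subset.Propositional using (_⊆_)
  open import Data.Product using (∃; _×_; _,_; proj₁; proj₂)
  open import Function using (_∘_)
  open import Data.Rational using (ℚ; 0ℚ; 1ℚ; _*_; _≤_; _<_; nonNegative)
  open import Data.Rational.Properties
  open import Data.Sum using (inj₁; inj₂)
  open import Relation.Binary.PropositionalEquality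
  open import Relation.Nullary using (contradiction)
  open import Data.Rational.Solver using (module +-*-Solver)
  open +-*-Solver
  open RationalArithmetic

  module _ {A : Set} (f : A → ℚ) where

    ∏ : List A → ℚ
    ∏ = foldr (λ x r → f x * r) 1ℚ

    ∏-++ : ∀ xs ys → ∏ (xs ++ ys) ≡ ∏ xs * ∏ ys
    ∏-++ []       ys = sym (*-identityˡ (∏ ys))
    ∏-++ (x ∷ xs) ys = trans (cong (f x *_) (∏-++ xs ys)) (sym (*-assoc (f x) (∏ xs) (∏ ys)))

    ∏-remove : ∀ {x xs} → x ∈ xs →
      ∃ λ ys → ∏ xs ≡ f x * ∏ ys × ys ⊆ xs × (∀ {y} → y ∈ xs → y ≢ x → y ∈ ys)
    ∏-remove {x} x∈xs with ∈-∃++ x∈xs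
    ... | us , vs , refl = us ++ vs , product , ⊆-whole , ∈-rest
      where
      product : ∏ (us ++ x ∷ vs) ≡ f x * ∏ (us ++ vs)
      product = begin
        ∏ (us ++ x ∷ vs)
          ≡⟨ ∏-++ us (x ∷ vs) ⟩
        ∏ us * (f x * ∏ vs)
          ≡⟨ solve 3 (λ u a v → u :* (a :* v) := a :* (u :* v)) refl (∏ us) (f x) (∏ vs) ⟩
        f x * (∏ us * ∏ vs)
          ≡⟨ cong (f x *_) (∏-++ us vs) ⟨
        f x * ∏ (us ++ vs) ∎
        where open ≡-Reasoning
      ⊆-whole : us ++ vs ⊆ us ++ x ∷ vs
      ⊆-whole y∈ with ∈-++⁻ us y∈
      ... | inj₁ y∈us = ∈-++⁺ˡ y∈us
      ... | inj₂ y∈vs = ∈-++⁺ʳ us (there y∈vs)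
      ∈-rest : ∀ {y} → y ∈ us ++ x ∷ vs → y ≢ x → y ∈ us ++ vs
      ∈-rest y∈ y≢x with ∈-++⁻ us y∈
      ... | inj₁ y∈us = ∈-++⁺ˡ y∈us
      ... | inj₂ (here y≡x) = contradiction y≡x y≢x
      ... | inj₂ (there y∈vs) = ∈-++⁺ʳ us y∈vs

    WithinUnit : List A → Set
    WithinUnit xs = ∀ {x} → x ∈ xs → 0ℚ < f x × f x ≤ 1ℚ

    ∏-withinUnit : ∀ xs → WithinUnit xs → 0ℚ < ∏ xs × ∏ xs ≤ 1ℚ
    ∏-withinUnit []       _ = 0<a/b 1 1 , ≤-refl
    ∏-withinUnit (x ∷ xs) h with h (here refl) | ∏-withinUnit xs (h ∘ there)
    ... | 0<fx , fx≤1 | 0<∏ , ∏≤1 = *-pos 0<fx 0<∏ , ≤-trans (p≤1⇒p*q≤q fx≤1 (<⇒≤ 0<∏)) ∏≤1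

    ∏-antimono : ∀ {xs} ys → Unique ys → ys ⊆ xs → WithinUnit xs → ∏ xs ≤ ∏ ys
    ∏-antimono {xs} []       _              _     h = proj₂ (∏-withinUnit xs h)
    ∏-antimono {xs} (y ∷ ys) (y≢ys ∷ uniq) ys⊆xs h with ∏-remove (ys⊆xs (here refl))
    ... | rest , ∏xs≡ , rest⊆xs , ∈-rest = begin
      ∏ xs         ≡⟨ ∏xs≡ ⟩
      f y * ∏ rest ≤⟨ *-monoˡ-≤-nonNeg (f y) {{nonNegative (<⇒≤ (proj₁ (h (ys⊆xs (here refl)))))}}
                        (∏-antimono ys uniq ys⊆rest (h ∘ rest⊆xs)) ⟩
      f y * ∏ ys ∎
      where
      open ≤-Reasoning
      ys⊆rest : ys ⊆ rest
      ys⊆rest z∈ys = ∈-rest (ys⊆xs (there z∈ys)) (λ z≡y → All.lookup y≢ys z∈ys (sym z≡y))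

module Divisors where

  open import Defs using (primeDivisors)
  open import Data.List using (List; []; _∷_; [_]; upTo)
  open import Data.List.Membership.Propositional using (_∈_)
  open import Data.List.Membership.Propositional.Properties using (∈-filter⁺; ∈-filter⁻; ∈-upTo⁺)
  open import Data.List.Relation.Unary.All using (_∷_)
  open import Data.List.Relation.Unary.AllPairs using (_∷_)
  open import Data.List.Relation.Unary.Any using (here; there)
  open import Data.List.Relation.Unary.Unique.Propositional using (Unique)
  import Data.List.Relation.Unary.Unique.Propositional.Properties as Unique
  open import Data.Nat.Base
  open import Data.Nat.Properties
  open import Data.Nat.Divisibility
  open import Data.Nat.GCD using (gcd; gcd[m,n]∣m; gcd[m,n]∣n; gcd-greatest; gcd[m,n]≢0)
  open import Data.Nat.Primality
  open import Data.Nat.Primality.Factorisation using (factorise)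
  open import Data.Product using (∃; _×_; _,_)
  open import Data.Sum using (_⊎_; inj₁; inj₂)
  open import Relation.Binary.PropositionalEquality hiding ([_])
  open import Relation.Nullary using (¬_; contradiction; yes; no)
  open import Relation.Nullary.Decidable using (_×-dec_)

  prime⇒2≤ : ∀ {p} → Prime p → 2 ≤ p
  prime⇒2≤ {p} pp = nonTrivial⇒n>1 p {{prime⇒nonTrivial pp}}

  prime⇒≢1 : ∀ {p} → Prime p → p ≢ 1
  prime⇒≢1 pp refl = ¬prime[1] pp

  ∃-prime-divisor : ∀ {n} → 2 ≤ n → ∃ λ p → Prime p × p ∣ n
  ∃-prime-divisor {n} 2≤n with factorise n {{>-nonZero (<-trans z<s 2≤n)}}
  ... | record { factors = [] ; isFactorisation = n≡1 } = contradiction n≡1 (>⇒≢ 2≤n)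
  ... | record { factors = p ∷ ps ; isFactorisation = n≡p*_ ; factorsPrime = pp ∷ _ } =
    p , pp , subst (p ∣_) (sym n≡p*_) (m∣m*n _)

  prime∣prime^⇒≡ : ∀ {p q} t → Prime p → Prime q → q ∣ p ^ t → q ≡ p
  prime∣prime^⇒≡ zero    pp pq q∣1 = contradiction (∣1⇒≡1 q∣1) (prime⇒≢1 pq)
  prime∣prime^⇒≡ {p} (suc t) pp pq q∣p^[1+t] with euclidsLemma p (p ^ t) pq q∣p^[1+t]
  ... | inj₂ q∣p^t = prime∣prime^⇒≡ t pp pq q∣p^t
  ... | inj₁ q∣p with prime⇒irreducible pp q∣p
  ...   | inj₁ q≡1 = contradiction q≡1 (prime⇒≢1 pq)
  ...   | inj₂ q≡p = q≡p

  common-divisor⇒gcd≢1 : ∀ {d x M} → d ≢ 1 → d ∣ x → d ∣ M → gcd x M ≢ 1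
  common-divisor⇒gcd≢1 d≢1 d∣x d∣M gcd≡1 = d≢1 (∣1⇒≡1 (subst (_ ∣_) gcd≡1 (gcd-greatest d∣x d∣M)))

  ≢0∧≢1⇒2≤ : ∀ {n} → n ≢ 0 → n ≢ 1 → 2 ≤ n
  ≢0∧≢1⇒2≤ {0}    n≢0 _   = contradiction refl n≢0
  ≢0∧≢1⇒2≤ {1}    _   n≢1 = contradiction refl n≢1
  ≢0∧≢1⇒2≤ {2+ _} _   _   = s≤s (s≤s z≤n)

  gcd≢1⇒∃-prime-divisor : ∀ {x M} → M ≢ 0 → gcd x M ≢ 1 → ∃ λ r → Prime r × r ∣ x × r ∣ M
  gcd≢1⇒∃-prime-divisor {x} {M} M≢0 gcd≢1
    with r , pr , r∣gcd ← ∃-prime-divisor (≢0∧≢1⇒2≤ (gcd[m,n]≢0 x M (inj₂ M≢0)) gcd≢1)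
    = r , pr , ∣-trans r∣gcd (gcd[m,n]∣m x M) , ∣-trans r∣gcd (gcd[m,n]∣n x M)

  prime^≢0 : ∀ {p} t → Prime p → p ^ t ≢ 0
  prime^≢0 {p} t pp = ≢-nonZero⁻¹ (p ^ t) {{m^n≢0 p t {{prime⇒nonZero pp}}}}

  gcd[x,p^t]≡1 : ∀ {x p} t → Prime p → ¬ p ∣ x → gcd x (p ^ t) ≡ 1
  gcd[x,p^t]≡1 {x} {p} t pp p∤x with gcd x (p ^ t) ≟ 1
  ... | yes gcd≡1 = gcd≡1
  ... | no gcd≢1 with r , pr , r∣x , r∣p^t ← gcd≢1⇒∃-prime-divisor (prime^≢0 t pp) gcd≢1 =
    contradiction (subst (_∣ x) (prime∣prime^⇒≡ t pp pr r∣p^t) r∣x) p∤x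

  ∈-primeDivisors⁺ : ∀ {q M} → M ≢ 0 → Prime q → q ∣ M → q ∈ primeDivisors M
  ∈-primeDivisors⁺ M≢0 pq q∣M =
    ∈-filter⁺ (λ q → prime? q ×-dec (q ∣? _)) (∈-upTo⁺ (s≤s (∣⇒≤ {{≢-nonZero M≢0}} q∣M))) (pq , q∣M)

  ∈-primeDivisors⁻ : ∀ {q M} → q ∈ primeDivisors M → Prime q × q ∣ M
  ∈-primeDivisors⁻ {M = M} q∈ with _ , pq×q∣M ← ∈-filter⁻ (λ q → prime? q ×-dec (q ∣? M)) {xs = upTo (suc M)} q∈ =
      pq×q∣M

  primeDivisors-unique : ∀ M → Unique (primeDivisors M)
  primeDivisors-unique M = Unique.filter⁺ (λ q → prime? q ×-dec (q ∣? M)) (Unique.upTo⁺ (suc M))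

  unique-constant⇒singleton : ∀ {A : Set} {x : A} {xs} → Unique xs → x ∈ xs → (∀ {y} → y ∈ xs → y ≡ x) → xs ≡ [ x ]
  unique-constant⇒singleton {xs = y ∷ []}    _                _ all≡x = cong [_] (all≡x (here refl))
  unique-constant⇒singleton {xs = y ∷ z ∷ _} ((y≢z ∷ _) ∷ _) _ all≡x =
    contradiction (trans (all≡x (here refl)) (sym (all≡x (there (here refl))))) y≢z

  primeDivisors[p^t] : ∀ {p} t → Prime p → 1 ≤ t → primeDivisors (p ^ t) ≡ [ p ]
  primeDivisors[p^t] {p} (suc t) pp _ = unique-constant⇒singleton (primeDivisors-unique (p ^ suc t))
    (∈-primeDivisors⁺ (prime^≢0 (suc t) pp) pp (m∣m*n (p ^ t)))
    (λ q∈ → let pq , q∣p^[1+t] = ∈-primeDivisors⁻ q∈ in prime∣prime^⇒≡ (suc t) pp pq q∣p^[1+t])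

  even⊎odd : ∀ n → 2 ∣ n ⊎ ∃ λ h → n ≡ suc (h * 2)
  even⊎odd zero          = inj₁ (divides 0 refl)
  even⊎odd (suc zero)    = inj₂ (0 , refl)
  even⊎odd (suc (suc n)) with even⊎odd n
  ... | inj₁ 2∣n        = inj₁ (∣m∣n⇒∣m+n ∣-refl 2∣n)
  ... | inj₂ (h , refl) = inj₂ (suc h , refl)

module AbsoluteNeighbours where

  open import Data.Integer as ℤ using (ℤ; +_; -[1+_])
  open import Data.Nat.Base using (ℕ; zero; suc; 2+)
  open import Data.Nat.Properties using (+-comm; +-identityʳ)
  open import Data.Nat.Divisibility
  open import Data.Product using (_,_)
  open import Data.Sum using (_⊎_; inj₁; inj₂)
  open import Relation.Binary.PropositionalEquality
  open Divisors using (even⊎odd)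

  data Neighbours : ℕ → ℕ → ℕ → Set where
    origin     : Neighbours 1 0 1
    ascending  : ∀ n → Neighbours n (suc n) (2+ n)
    descending : ∀ n → Neighbours (2+ n) (suc n) n

  abs-neighbours : ∀ m → Neighbours ℤ.∣ m ℤ.- + 1 ∣ ℤ.∣ m ∣ ℤ.∣ m ℤ.+ + 1 ∣
  abs-neighbours (+ zero)       = origin
  abs-neighbours (+ suc n)      = subst (Neighbours n (suc n)) (cong suc (+-comm 1 n)) (ascending n)
  abs-neighbours -[1+ zero ]    = descending 0
  abs-neighbours -[1+ suc n ]   =
    subst (λ x → Neighbours x (2+ n) (suc n)) (cong (λ k → 2+ (suc k)) (sym (+-identityʳ n))) (descending (suc n))

  neighbours-sym : ∀ {x c y} → Neighbours x c y → Neighbours y c x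
  neighbours-sym origin         = origin
  neighbours-sym (ascending n)  = descending n
  neighbours-sym (descending n) = ascending n

  private
    adjacent-coprime : ∀ {d n} → d ∣ n → d ∣ suc n → d ≡ 1
    adjacent-coprime {d} {n} d∣n d∣1+n = ∣1⇒≡1 (∣m+n∣m⇒∣n (subst (d ∣_) (+-comm 1 n) d∣1+n) d∣n)

    ∣n∧∣2+n⇒∣2 : ∀ {d n} → d ∣ n → d ∣ 2+ n → d ∣ 2
    ∣n∧∣2+n⇒∣2 {d} {n} d∣n d∣2+n = ∣m+n∣m⇒∣n (subst (d ∣_) (+-comm 2 n) d∣2+n) d∣n

    residue-mod-3 : ∀ n → 3 ∣ n ⊎ 3 ∣ suc n ⊎ 3 ∣ 2+ n
    residue-mod-3 zero    = inj₁ (divides 0 refl)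
    residue-mod-3 (suc n) with residue-mod-3 n
    ... | inj₁ 3∣n          = inj₂ (inj₂ (∣m∣n⇒∣m+n ∣-refl 3∣n))
    ... | inj₂ (inj₁ 3∣1+n) = inj₁ 3∣1+n
    ... | inj₂ (inj₂ 3∣2+n) = inj₂ (inj₁ 3∣2+n)

  neighbours-coprimeˡ : ∀ {x c y d} → Neighbours x c y → d ∣ x → d ∣ c → d ≡ 1
  neighbours-coprimeˡ origin         d∣1   _     = ∣1⇒≡1 d∣1
  neighbours-coprimeˡ (ascending n)  d∣n   d∣1+n = adjacent-coprime d∣n d∣1+n
  neighbours-coprimeˡ (descending n) d∣2+n d∣1+n = adjacent-coprime d∣1+n d∣2+n

  neighbours-coprimeʳ : ∀ {x c y d} → Neighbours x c y → d ∣ y → d ∣ c → d ≡ 1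
  neighbours-coprimeʳ N = neighbours-coprimeˡ (neighbours-sym N)

  neighbours-outer : ∀ {x c y d} → Neighbours x c y → d ∣ x → d ∣ y → d ∣ 2
  neighbours-outer origin         d∣1   _     = ∣-trans d∣1 (1∣ 2)
  neighbours-outer (ascending n)  d∣n   d∣2+n = ∣n∧∣2+n⇒∣2 d∣n d∣2+n
  neighbours-outer (descending n) d∣2+n d∣n   = ∣n∧∣2+n⇒∣2 d∣n d∣2+n

  neighbours-even : ∀ {x c y} → Neighbours x c y → 2 ∣ x ⊎ 2 ∣ c
  neighbours-even origin         = inj₂ (divides 0 refl)
  neighbours-even (ascending n) with even⊎odd n
  ... | inj₁ 2∣n        = inj₁ 2∣n
  ... | inj₂ (h , refl) = inj₂ (divides (suc h) refl)
  neighbours-even (descending n) with even⊎odd (suc n)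
  ... | inj₁ 2∣1+n      = inj₂ 2∣1+n
  ... | inj₂ (h , refl) = inj₁ (divides (suc h) refl)

  neighbours-mod-3 : ∀ {x c y} → Neighbours x c y → 3 ∣ x ⊎ 3 ∣ c ⊎ 3 ∣ y
  neighbours-mod-3 origin         = inj₂ (inj₁ (divides 0 refl))
  neighbours-mod-3 (ascending n)  = residue-mod-3 n
  neighbours-mod-3 (descending n) with residue-mod-3 n
  ... | inj₁ 3∣n          = inj₂ (inj₂ 3∣n)
  ... | inj₂ (inj₁ 3∣1+n) = inj₂ (inj₁ 3∣1+n)
  ... | inj₂ (inj₂ 3∣2+n) = inj₁ 3∣2+n

module LocalFactors where

  open import Defs
  open import Data.Integer as ℤ using (ℤ; +_)
  open import Data.List using ([]; _∷_; [_]; length)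
  open import Data.List.Properties using (filter-accept)
  open import Data.List.Relation.Unary.AllPairs using ([]; _∷_)
  open import Data.List.Relation.Unary.All using ([]; _∷_)
  open import Data.List.Relation.Unary.Any using (here)
  open import Data.List.Membership.Propositional using (_∈_)
  open import Data.List.Relation.Unary.Unique.Propositional using (Unique)
  open import Data.Nat as ℕ using (ℕ; suc; _∸_; _^_; z≤n; s≤s)
  import Data.Nat.Properties as ℕ
  open import Data.Nat.Divisibility using (_∣_; _∣?_)
  open import Data.Nat.GCD using (gcd; gcd-zeroˡ)
  open import Data.Nat.Primality using (Prime)
  open import Data.Product using (_×_; _,_; proj₁; proj₂)
  open import Data.Rational using (ℚ; _/_; 0ℚ; 1ℚ; _+_; _*_; _-_; -_; _≤_; _<_)
  open import Data.Rational.Properties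
  open import Function.Bundles using (_⇔_; Equivalence)
  open import Relation.Binary.PropositionalEquality hiding ([_])
  open import Relation.Nullary using (¬_; does; ¬?; yes; no)
  open import Relation.Nullary.Decidable using (dec-true; dec-false; toWitness)
  open import Data.Rational.Solver using (module +-*-Solver)
  open +-*-Solver
  open RationalArithmetic
  open ListProducts
  open Divisors

  two : ℚ
  two = ι (+ 2)

  localFactor-∣ : ∀ {c q} → q ∣ c → localFactor (+ c) q ≡ + q / suc q
  localFactor-∣ {c} {q} q∣c rewrite dec-false (¬? (q ∣? c)) (λ q∤c → q∤c q∣c) =
    solve 2 (λ i x → (con 1ℚ :- con 0ℚ :* i) :* x := x) refl (inv (q ℕ.* q ∸ q)) (+ q / suc q)

  localFactor-∤ : ∀ {c q} → ¬ q ∣ c → localFactor (+ c) q ≡ (1ℚ - inv (q ℕ.* q ∸ q)) * (+ q / suc q)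
  localFactor-∤ {c} {q} q∤c rewrite dec-true (¬? (q ∣? c)) q∤c =
    cong (λ i → (1ℚ - i) * (+ q / suc q)) (*-identityˡ (inv (q ℕ.* q ∸ q)))

  0≤inv : ∀ n → 0ℚ ≤ inv n
  0≤inv ℕ.zero  = ≤-refl
  0≤inv (suc n) = 0≤a/b 1 (suc n)

  inv-antimono : ∀ {m n} → 1 ℕ.≤ m → m ℕ.≤ n → inv n ≤ inv m
  inv-antimono {suc m} {suc n} _ 1+m≤1+n = cross-≤ 1 (suc n) 1 (suc m) (ℕ.*-monoʳ-≤ 1 1+m≤1+n)

  0<1-inv : ∀ {n} → 2 ℕ.≤ n → 0ℚ < 1ℚ - inv n
  0<1-inv {1} (s≤s ())
  0<1-inv {suc (suc n)} _ = Equivalence.from 0<q-p⇔p<q (cross-< 1 (suc (suc n)) 1 1 (s≤s (s≤s z≤n)))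

  1-inv≤1 : ∀ n → 1ℚ - inv n ≤ 1ℚ
  1-inv≤1 n = +-monoʳ-≤ 1ℚ (neg-antimono-≤ (0≤inv n))

  q²-q-mono : ∀ {a q} → a ℕ.≤ q → a ℕ.* (a ∸ 1) ℕ.≤ q ℕ.* q ∸ q
  q²-q-mono {a} {q} a≤q = ℕ.≤-trans (ℕ.*-mono-≤ a≤q (ℕ.∸-monoˡ-≤ 1 a≤q))
    (ℕ.≤-reflexive (trans (ℕ.*-distribˡ-∸ q q 1) (cong (q ℕ.* q ∸_) (ℕ.*-identityʳ q))))

  q/[1+q]<1 : ∀ q → + q / suc q < 1ℚ
  q/[1+q]<1 q = cross-< q (suc q) 1 1 (subst₂ ℕ._<_ (sym (ℕ.*-identityʳ q)) (sym (ℕ.*-identityˡ (suc q))) (ℕ.n<1+n q))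

  localFactor-bounds : ∀ {c q} → 2 ℕ.≤ q → 0ℚ < localFactor (+ c) q × localFactor (+ c) q < 1ℚ
  localFactor-bounds {q = 1} (s≤s ())
  localFactor-bounds {c} {q@(suc (suc k))} 2≤q with q ∣? c
  ... | yes q∣c = subst (λ F → 0ℚ < F × F < 1ℚ) (sym (localFactor-∣ q∣c)) (0<a/b q (suc q) , q/[1+q]<1 q)
  ... | no q∤c  = subst (λ F → 0ℚ < F × F < 1ℚ) (sym (localFactor-∤ q∤c))
    ( *-pos (0<1-inv {q ℕ.* q ∸ q} (q²-q-mono {a = 2} 2≤q)) (0<a/b q (suc q))
    , ≤-<-trans (p≤1⇒p*q≤q (1-inv≤1 (q ℕ.* q ∸ q)) (0≤a/b q (suc q))) (q/[1+q]<1 q))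

  3[1+p]≤4p : ∀ {p} → 3 ℕ.≤ p → 3 ℕ.* suc p ℕ.≤ p ℕ.* 4
  3[1+p]≤4p {p} 3≤p = begin
    3 ℕ.* suc p     ≡⟨ ℕ.*-suc 3 p ⟩
    3 ℕ.+ 3 ℕ.* p   ≤⟨ ℕ.+-monoˡ-≤ (3 ℕ.* p) 3≤p ⟩
    p ℕ.+ 3 ℕ.* p   ≡⟨ cong (p ℕ.+_) (ℕ.*-comm 3 p) ⟩
    p ℕ.+ p ℕ.* 3   ≡⟨ ℕ.*-suc p 3 ⟨
    p ℕ.* 4 ∎
    where open ℕ.≤-Reasoning

  localFactor-∤-lowerBound : ∀ {c p} → 3 ℕ.≤ p → ¬ p ∣ c → (1ℚ - inv 6) * (+ 3 / 4) ≤ localFactor (+ c) p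
  localFactor-∤-lowerBound {c} {p@(suc p-1)} 3≤p p∤c = begin
    (1ℚ - inv 6) * (+ 3 / 4)
      ≤⟨ *-mono-≤-nonNeg (toWitness {a? = 0ℚ ≤? 1ℚ - inv 6} _) (0≤a/b p (suc p))
        (+-monoʳ-≤ 1ℚ (neg-antimono-≤ (inv-antimono (s≤s z≤n) (q²-q-mono 3≤p))))
        (cross-≤ 3 4 p (suc p) (3[1+p]≤4p 3≤p)) ⟩
    (1ℚ - inv (p ℕ.* p ∸ p)) * (+ p / suc p)
      ≡⟨ localFactor-∤ p∤c ⟨
    localFactor (+ c) p ∎
    where
    open ≤-Reasoning

  1<two*localFactor : ∀ {c p} → 3 ℕ.≤ p → ¬ p ∣ c → 1ℚ < two * localFactor (+ c) p
  1<two*localFactor 3≤p p∤c = <-≤-trans (toWitness {a? = 1ℚ <? two * ((1ℚ - inv 6) * (+ 3 / 4))} _)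
    (*-monoˡ-≤-nonNeg two (localFactor-∤-lowerBound 3≤p p∤c))

  localProduct : ℕ → ℕ → ℚ
  localProduct c M = ∏ (localFactor (+ c)) (primeDivisors M)

  module _ {c M : ℕ} where

    localProduct-withinUnit : WithinUnit (localFactor (+ c)) (primeDivisors M)
    localProduct-withinUnit q∈ with localFactor-bounds (prime⇒2≤ (proj₁ (∈-primeDivisors⁻ {M = M} q∈)))
    ... | 0<F , F<1 = 0<F , <⇒≤ F<1

    localProduct-pos : 0ℚ < localProduct c M
    localProduct-pos = proj₁ (∏-withinUnit _ (primeDivisors M) localProduct-withinUnit)

    localProduct-≤ : ∀ {qs} → M ≢ 0 → Unique qs → (∀ {q} → q ∈ qs → Prime q × q ∣ M) →
                     localProduct c M ≤ ∏ (localFactor (+ c)) qs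
    localProduct-≤ {qs} M≢0 uniq qs-divide = ∏-antimono _ qs uniq
      (λ q∈qs → let pq , q∣M = qs-divide q∈qs in ∈-primeDivisors⁺ M≢0 pq q∣M) localProduct-withinUnit

    localProduct<1 : 2 ℕ.≤ M → localProduct c M < 1ℚ
    localProduct<1 2≤M with r , pr , r∣M ← ∃-prime-divisor 2≤M = begin-strict
      localProduct c M            ≤⟨ localProduct-≤ M≢0 ([] ∷ []) (λ { (here refl) → pr , r∣M }) ⟩
      localFactor (+ c) r * 1ℚ    ≡⟨ *-identityʳ _ ⟩
      localFactor (+ c) r         <⟨ proj₂ (localFactor-bounds (prime⇒2≤ pr)) ⟩
      1ℚ ∎
      where
      open ≤-Reasoning
      M≢0 : M ≢ 0
      M≢0 M≡0 = ℕ.<⇒≢ (ℕ.<-trans (s≤s z≤n) 2≤M) (sym M≡0)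

  localProduct[p^t] : ∀ {c p} t → Prime p → 1 ℕ.≤ t → localProduct c (p ^ t) ≡ localFactor (+ c) p
  localProduct[p^t] t pp 1≤t rewrite primeDivisors[p^t] t pp 1≤t = *-identityʳ _

  -- bias m M unfolds to inv (2 ℕ.* φ M) * biasNumerator ℤ.∣ m ℤ.- + 1 ∣ ℤ.∣ m ∣ ℤ.∣ m ℤ.+ + 1 ∣ M.
  biasNumerator : ℕ → ℕ → ℕ → ℕ → ℚ
  biasNumerator x c y M = two * localProduct c M - δ (does (gcd x M ℕ.≟ 1)) - δ (does (gcd y M ℕ.≟ 1))

  biasNumerator-swap : ∀ x c y M → biasNumerator x c y M ≡ biasNumerator y c x M
  biasNumerator-swap x c y M = solve 3 (λ p a b → p :- a :- b := p :- b :- a) refl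
    (two * localProduct c M) (δ (does (gcd x M ℕ.≟ 1))) (δ (does (gcd y M ℕ.≟ 1)))

  module _ {x M : ℕ} where

    δ-coprime : gcd x M ≡ 1 → δ (does (gcd x M ℕ.≟ 1)) ≡ 1ℚ
    δ-coprime gcd≡1 = cong δ (dec-true (gcd x M ℕ.≟ 1) gcd≡1)

    δ-not-coprime : gcd x M ≢ 1 → δ (does (gcd x M ℕ.≟ 1)) ≡ 0ℚ
    δ-not-coprime gcd≢1 = cong δ (dec-false (gcd x M ℕ.≟ 1) gcd≢1)

  0<two : 0ℚ < two
  0<two = 0<a/b 2 1

  module _ {x c y M : ℕ} where

    biasNumerator-pos : gcd x M ≢ 1 → gcd y M ≢ 1 → 0ℚ < biasNumerator x c y M
    biasNumerator-pos gx≢1 gy≢1 = begin-strict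
      0ℚ
        <⟨ *-pos 0<two (localProduct-pos {c} {M}) ⟩
      two * localProduct c M
        ≡⟨ solve 1 (λ p → p := p :- con 0ℚ :- con 0ℚ) refl (two * localProduct c M) ⟩
      two * localProduct c M - 0ℚ - 0ℚ
        ≡⟨ cong₂ (λ a b → two * localProduct c M - a - b)
          (δ-not-coprime {x} {M} gx≢1) (δ-not-coprime {y} {M} gy≢1) ⟨
      biasNumerator x c y M ∎
      where open ≤-Reasoning

    biasNumerator-neg : 2 ℕ.≤ M → gcd x M ≡ 1 → gcd y M ≡ 1 → biasNumerator x c y M < 0ℚ
    biasNumerator-neg 2≤M gx≡1 gy≡1 = subst (_< 0ℚ) (sym numerator≡) (Equivalence.from q-p<0⇔q<p 2P<2)
      where
      numerator≡ : biasNumerator x c y M ≡ two * localProduct c M - two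
      numerator≡ = trans (cong₂ (λ a b → two * localProduct c M - a - b) (δ-coprime {x} {M} gx≡1)
          (δ-coprime {y} {M} gy≡1))
        (solve 1 (λ p → p :- con 1ℚ :- con 1ℚ := p :- con two) refl (two * localProduct c M))
      2P<2 : two * localProduct c M < two
      2P<2 = subst (two * localProduct c M <_) (*-identityʳ two) (*-monoʳ-<-pos two (localProduct<1 {c} {M} 2≤M))

    biasNumerator-coprimeˡ : gcd x M ≡ 1 → gcd y M ≢ 1 → biasNumerator x c y M ≡ two * localProduct c M - 1ℚ
    biasNumerator-coprimeˡ gx≡1 gy≢1 =
      trans (cong₂ (λ a b → two * localProduct c M - a - b) (δ-coprime {x} {M} gx≡1) (δ-not-coprime {y} {M} gy≢1))
        (solve 1 (λ p → p :- con 1ℚ :- con 0ℚ := p :- con 1ℚ) refl (two * localProduct c M))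

  φ[1+M]≥1 : ∀ M → 1 ℕ.≤ φ (suc M)
  φ[1+M]≥1 M = subst (1 ℕ.≤_)
    (sym (cong length (filter-accept (λ k → gcd k (suc M) ℕ.≟ 1) {x = 1} (gcd-zeroˡ (suc M))))) (s≤s z≤n)

  0<inv[2φ] : ∀ {M} → 1 ℕ.≤ M → 0ℚ < inv (2 ℕ.* φ M)
  0<inv[2φ] {suc M} _ with φ (suc M) | φ[1+M]≥1 M
  ... | suc k | _ = 0<a/b 1 (2 ℕ.* suc k)

  module _ (m : ℤ) {M : ℕ} (1≤M : 1 ℕ.≤ M) where

    0<bias⇔0<biasNumerator : 0ℚ < bias m M ⇔ 0ℚ < biasNumerator ℤ.∣ m ℤ.- + 1 ∣ ℤ.∣ m ∣ ℤ.∣ m ℤ.+ + 1 ∣ M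
    0<bias⇔0<biasNumerator = 0<w*x⇔0<x (0<inv[2φ] 1≤M)

    bias<0⇔biasNumerator<0 : bias m M < 0ℚ ⇔ biasNumerator ℤ.∣ m ℤ.- + 1 ∣ ℤ.∣ m ∣ ℤ.∣ m ℤ.+ + 1 ∣ M < 0ℚ
    bias<0⇔biasNumerator<0 = w*x<0⇔x<0 (0<inv[2φ] 1≤M)

module SignOfBias where

  open import Defs
  open import Data.Integer as ℤ using (ℤ; +_)
  open import Data.List using ([]; _∷_)
  open import Data.List.Relation.Unary.AllPairs using ([]; _∷_)
  open import Data.List.Relation.Unary.All using ([]; _∷_)
  open import Data.List.Relation.Unary.Any using (here; there)
  open import Data.List.Membership.Propositional using (_∈_)
  open import Data.List.Relation.Unary.Unique.Propositional using (Unique)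
  open import Data.Nat as ℕ using (ℕ; suc; _^_)
  import Data.Nat.Properties as ℕ
  open import Data.Nat.Divisibility using (_∣_; _∣?_; ∣-refl; ∣-trans; ∣⇒≤; divides; m∣m*n)
  open import Data.Nat.GCD using (gcd)
  open import Data.Nat.Primality using (Prime; prime?; prime[2]; prime⇒nonZero)
  open import Function.Construct.Composition using (_⇔-∘_)
  open import Data.Product using (_×_; _,_; proj₂)
  open import Data.Sum using (_⊎_; inj₁; inj₂)
  open import Data.Rational using (_/_; 0ℚ; 1ℚ; _*_; _-_; _≤_; _<_)
  open import Data.Rational.Properties
  open import Function.Bundles using (_⇔_; mk⇔; Equivalence)
  open import Relation.Binary.PropositionalEquality
  open import Relation.Nullary using (¬_; yes; no; contradiction)
  open import Relation.Nullary.Decidable using (toWitness)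
  open import Data.Rational.Solver using (module +-*-Solver)
  open +-*-Solver
  open RationalArithmetic
  open Divisors
  open AbsoluteNeighbours
  open LocalFactors

  odd-prime⇒3≤ : ∀ {p} → Prime p → ¬ 2 ∣ p → 3 ℕ.≤ p
  odd-prime⇒3≤ pp p-odd = ℕ.≤∧≢⇒< (prime⇒2≤ pp) (λ 2≡p → p-odd (subst (2 ∣_) 2≡p ∣-refl))

  odd-prime∤2 : ∀ {p} → Prime p → ¬ 2 ∣ p → ¬ p ∣ 2
  odd-prime∤2 pp p-odd p∣2 = ℕ.<⇒≱ (odd-prime⇒3≤ pp p-odd) (∣⇒≤ p∣2)

  n∣n^t : ∀ {n t} → 1 ℕ.≤ t → n ∣ n ^ t
  n∣n^t {n} {suc t} _ = m∣m*n (n ^ t)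

  module _ {p : ℕ} (t : ℕ) (pp : Prime p) (p-odd : ¬ 2 ∣ p) (1≤t : 1 ℕ.≤ t) where

    private
      p∣p^t : p ∣ p ^ t
      p∣p^t = n∣n^t 1≤t

      gcd≢1 : ∀ {z} → p ∣ z → gcd z (p ^ t) ≢ 1
      gcd≢1 p∣z = common-divisor⇒gcd≢1 (prime⇒≢1 pp) p∣z p∣p^t

    0<biasNumerator[p^t] : ∀ {x c y} → Neighbours x c y → p ∣ x → 0ℚ < biasNumerator x c y (p ^ t)
    0<biasNumerator[p^t] {x} {c} {y} N p∣x = subst (0ℚ <_) (sym numerator≡) (Equivalence.from 0<q-p⇔p<q 1<2P)
      where
      p∤y : ¬ p ∣ y
      p∤y p∣y = odd-prime∤2 pp p-odd (neighbours-outer N p∣x p∣y)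
      p∤c : ¬ p ∣ c
      p∤c p∣c = prime⇒≢1 pp (neighbours-coprimeˡ N p∣x p∣c)
      numerator≡ : biasNumerator x c y (p ^ t) ≡ two * localProduct c (p ^ t) - 1ℚ
      numerator≡ = trans (biasNumerator-swap x c y (p ^ t))
        (biasNumerator-coprimeˡ {y} {c} {x} {p ^ t} (gcd[x,p^t]≡1 t pp p∤y) (gcd≢1 p∣x))
      1<2P : 1ℚ < two * localProduct c (p ^ t)
      1<2P = subst (λ P → 1ℚ < two * P) (sym (localProduct[p^t] t pp 1≤t))
        (1<two*localFactor (odd-prime⇒3≤ pp p-odd) p∤c)

    0<biasNumerator[p^t]⇔ : ∀ {x c y} → Neighbours x c y → 0ℚ < biasNumerator x c y (p ^ t) ⇔ (p ∣ x ⊎ p ∣ y)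
    0<biasNumerator[p^t]⇔ {x} {c} {y} N = mk⇔ to from
      where
      to : 0ℚ < biasNumerator x c y (p ^ t) → p ∣ x ⊎ p ∣ y
      to 0<B with p ∣? x | p ∣? y
      ... | yes p∣x | _       = inj₁ p∣x
      ... | no _    | yes p∣y = inj₂ p∣y
      ... | no p∤x  | no p∤y  = contradiction 0<B (<-asym (biasNumerator-neg {x} {c} {y} {p ^ t}
              (ℕ.≤-trans (prime⇒2≤ pp) (∣⇒≤ {{ℕ.m^n≢0 p t {{prime⇒nonZero pp}}}} p∣p^t))
              (gcd[x,p^t]≡1 t pp p∤x) (gcd[x,p^t]≡1 t pp p∤y)))
      from : p ∣ x ⊎ p ∣ y → 0ℚ < biasNumerator x c y (p ^ t)
      from (inj₁ p∣x) = 0<biasNumerator[p^t] N p∣x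
      from (inj₂ p∣y) = subst (0ℚ <_) (biasNumerator-swap y c x (p ^ t)) (0<biasNumerator[p^t] (neighbours-sym N) p∣y)

  prime[3] : Prime 3
  prime[3] = toWitness {a? = prime? 3} _

  module _ {M : ℕ} (2≤M : 2 ℕ.≤ M) (6∣M : 6 ∣ M) where

    private
      M≢0 : M ≢ 0
      M≢0 refl = contradiction 2≤M λ ()

      2∣M : 2 ∣ M
      2∣M = ∣-trans (divides 3 refl) 6∣M

      3∣M : 3 ∣ M
      3∣M = ∣-trans (divides 2 refl) 6∣M

      2∤x : ∀ {x} → gcd x M ≡ 1 → ¬ 2 ∣ x
      2∤x gx≡1 2∣x = common-divisor⇒gcd≢1 (λ ()) 2∣x 2∣M gx≡1

      2,3-unique : Unique (2 ∷ 3 ∷ [])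
      2,3-unique = ((λ ()) ∷ []) ∷ [] ∷ []

      2,3-divide : ∀ {q} → q ∈ 2 ∷ 3 ∷ [] → Prime q × q ∣ M
      2,3-divide (here refl)         = prime[2] , 2∣M
      2,3-divide (there (here refl)) = prime[3] , 3∣M

    -- 2 F(2) F(3) is 5/6 when 3 ∤ c but 1 when 3 ∣ c; then a prime factor r of y, which is
    -- neither 2 nor 3 since 2 ∣ c and 3 ∣ c, supplies the missing factor F(r) < 1.
    two*localProduct<1 : ∀ {x c y} → Neighbours x c y → gcd x M ≡ 1 → gcd y M ≢ 1 → two * localProduct c M < 1ℚ
    two*localProduct<1 {x} {c} {y} N gx≡1 gy≢1 with neighbours-even N | neighbours-mod-3 N
    ... | inj₁ 2∣x | _ = contradiction 2∣x (2∤x gx≡1)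
    ... | inj₂ 2∣c | inj₁ 3∣x = contradiction gx≡1 (common-divisor⇒gcd≢1 (λ ()) 3∣x 3∣M)
    ... | inj₂ 2∣c | inj₂ (inj₂ 3∣y) = begin-strict
      two * localProduct c M
        ≤⟨ *-monoˡ-≤-nonNeg two (localProduct-≤ M≢0 2,3-unique 2,3-divide) ⟩
      two * (F 2 * (F 3 * 1ℚ))
        ≡⟨ cong₂ (λ a b → two * (a * (b * 1ℚ))) (localFactor-∣ 2∣c) (localFactor-∤ 3∤c) ⟩
      two * (+ 2 / 3 * ((1ℚ - inv 6) * (+ 3 / 4) * 1ℚ))
        <⟨ toWitness {a? = _ <? 1ℚ} _ ⟩
      1ℚ ∎
      where
      open ≤-Reasoning
      F = localFactor (+ c)
      3∤c : ¬ 3 ∣ c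
      3∤c 3∣c = contradiction (neighbours-coprimeʳ N 3∣y 3∣c) (λ ())
    ... | inj₂ 2∣c | inj₂ (inj₁ 3∣c) with r , pr , r∣y , r∣M ← gcd≢1⇒∃-prime-divisor {y} M≢0 gy≢1 = begin-strict
      two * localProduct c M
        ≤⟨ *-monoˡ-≤-nonNeg two (localProduct-≤ M≢0 2,3,r-unique 2,3,r-divide) ⟩
      two * (F 2 * (F 3 * (F r * 1ℚ)))
        ≡⟨ cong₂ (λ a b → two * (a * (b * (F r * 1ℚ)))) (localFactor-∣ 2∣c) (localFactor-∣ 3∣c) ⟩
      two * (+ 2 / 3 * (+ 3 / 4 * (F r * 1ℚ)))
        ≡⟨ solve 1 (λ f → con two :* (con (+ 2 / 3) :* (con (+ 3 / 4) :* (f :* con 1ℚ))) := f) refl (F r) ⟩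
      F r
        <⟨ proj₂ (localFactor-bounds (prime⇒2≤ pr)) ⟩
      1ℚ ∎
      where
      open ≤-Reasoning
      F = localFactor (+ c)
      r≢ : ∀ {d} → d ≢ 1 → d ∣ c → r ≢ d
      r≢ d≢1 d∣c refl = d≢1 (neighbours-coprimeʳ N r∣y d∣c)
      2,3,r-unique : Unique (2 ∷ 3 ∷ r ∷ [])
      2,3,r-unique = ((λ ()) ∷ (λ 2≡r → r≢ (λ ()) 2∣c (sym 2≡r)) ∷ [])
                   ∷ ((λ 3≡r → r≢ (λ ()) 3∣c (sym 3≡r)) ∷ []) ∷ [] ∷ []
      2,3,r-divide : ∀ {q} → q ∈ 2 ∷ 3 ∷ r ∷ [] → Prime q × q ∣ M
      2,3,r-divide (here refl)                 = prime[2] , 2∣M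
      2,3,r-divide (there (here refl))         = prime[3] , 3∣M
      2,3,r-divide (there (there (here refl))) = pr , r∣M

    biasNumerator<0-if-coprimeˡ : ∀ {x c y} → Neighbours x c y → gcd x M ≡ 1 → biasNumerator x c y M < 0ℚ
    biasNumerator<0-if-coprimeˡ {x} {c} {y} N gx≡1 with gcd y M ℕ.≟ 1
    ... | yes gy≡1 = biasNumerator-neg {x} {c} {y} {M} 2≤M gx≡1 gy≡1
    ... | no gy≢1  = subst (_< 0ℚ) (sym (biasNumerator-coprimeˡ {x} {c} {y} {M} gx≡1 gy≢1))
                       (Equivalence.from q-p<0⇔q<p (two*localProduct<1 N gx≡1 gy≢1))

    biasNumerator<0⇔ : ∀ {x c y} → Neighbours x c y → biasNumerator x c y M < 0ℚ ⇔ (gcd x M ≡ 1 ⊎ gcd y M ≡ 1)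
    biasNumerator<0⇔ {x} {c} {y} N = mk⇔ to from
      where
      to : biasNumerator x c y M < 0ℚ → gcd x M ≡ 1 ⊎ gcd y M ≡ 1
      to B<0 with gcd x M ℕ.≟ 1 | gcd y M ℕ.≟ 1
      ... | yes gx≡1 | _        = inj₁ gx≡1
      ... | no _     | yes gy≡1 = inj₂ gy≡1
      ... | no gx≢1  | no gy≢1  = contradiction B<0 (<-asym (biasNumerator-pos {x} {c} {y} {M} gx≢1 gy≢1))
      from : gcd x M ≡ 1 ⊎ gcd y M ≡ 1 → biasNumerator x c y M < 0ℚ
      from (inj₁ gx≡1) = biasNumerator<0-if-coprimeˡ N gx≡1
      from (inj₂ gy≡1) = subst (_< 0ℚ) (biasNumerator-swap y c x M)
          (biasNumerator<0-if-coprimeˡ (neighbours-sym N) gy≡1)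

  0<bias[p^t]⇔ : ∀ m p t → Prime p → ¬ 2 ∣ p → 1 ℕ.≤ t →
    0ℚ < bias m (p ^ t) ⇔ (p ∣ ℤ.∣ m ℤ.- + 1 ∣ ⊎ p ∣ ℤ.∣ m ℤ.+ + 1 ∣)
  0<bias[p^t]⇔ m p t pp p-odd 1≤t = 0<biasNumerator[p^t]⇔ t pp p-odd 1≤t (abs-neighbours m)
    ⇔-∘ 0<bias⇔0<biasNumerator m (ℕ.m^n>0 p {{prime⇒nonZero pp}} t)

  6∣M⇒bias<0⇔ : ∀ m M → 1 ℕ.< M → 6 ∣ M →
    bias m M < 0ℚ ⇔ (gcd ℤ.∣ m ℤ.- + 1 ∣ M ≡ 1 ⊎ gcd ℤ.∣ m ℤ.+ + 1 ∣ M ≡ 1)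
  6∣M⇒bias<0⇔ m M 1<M 6∣M = biasNumerator<0⇔ 1<M 6∣M (abs-neighbours m) ⇔-∘ bias<0⇔biasNumerator<0 m (ℕ.<⇒≤ 1<M)

module FiniteSums where

  open import Data.Nat.Base
  open import Data.Nat.Properties
  open import Data.Nat.Solver using (module +-*-Solver)
  open +-*-Solver
  open import Function using (_∘_)
  open import Relation.Binary.PropositionalEquality
  open import Relation.Nullary using (yes; no)

  ∑ : ℕ → (ℕ → ℕ) → ℕ
  ∑ zero    f = 0
  ∑ (suc n) f = ∑ n f + f n

  ∑-cong : ∀ n {f g} → (∀ i → i < n → f i ≡ g i) → ∑ n f ≡ ∑ n g
  ∑-cong zero    _   = refl
  ∑-cong (suc n) f≡g = cong₂ _+_ (∑-cong n (λ i i<n → f≡g i (m<n⇒m<1+n i<n))) (f≡g n ≤-refl)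

  ∑-mono-≤ : ∀ n {f g} → (∀ i → i < n → f i ≤ g i) → ∑ n f ≤ ∑ n g
  ∑-mono-≤ zero    _   = z≤n
  ∑-mono-≤ (suc n) f≤g = +-mono-≤ (∑-mono-≤ n (λ i i<n → f≤g i (m<n⇒m<1+n i<n))) (f≤g n ≤-refl)

  ∑-distrib-+ : ∀ n f g → ∑ n (λ i → f i + g i) ≡ ∑ n f + ∑ n g
  ∑-distrib-+ zero    f g = refl
  ∑-distrib-+ (suc n) f g = trans (cong (_+ (f n + g n)) (∑-distrib-+ n f g))
    (solve 4 (λ a b c d → (a :+ b) :+ (c :+ d) := (a :+ c) :+ (b :+ d)) refl (∑ n f) (∑ n g) (f n) (g n))

  ∑-*ˡ : ∀ n a f → ∑ n (λ i → a * f i) ≡ a * ∑ n f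
  ∑-*ˡ zero    a f = sym (*-zeroʳ a)
  ∑-*ˡ (suc n) a f = trans (cong (_+ a * f n) (∑-*ˡ n a f)) (sym (*-distribˡ-+ a (∑ n f) (f n)))

  ∑-const : ∀ n c → ∑ n (λ _ → c) ≡ n * c
  ∑-const zero    c = refl
  ∑-const (suc n) c = trans (cong (_+ c) (∑-const n c)) (+-comm (n * c) c)

  ∑-zero : ∀ n {f} → (∀ i → i < n → f i ≡ 0) → ∑ n f ≡ 0
  ∑-zero n f≡0 = trans (∑-cong n f≡0) (trans (∑-const n 0) (*-zeroʳ n))

  ∑-+ : ∀ a b f → ∑ (a + b) f ≡ ∑ a f + ∑ b (λ j → f (a + j))
  ∑-+ a zero    f = trans (cong (λ n → ∑ n f) (+-identityʳ a)) (sym (+-identityʳ (∑ a f)))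
  ∑-+ a (suc b) f = begin
    ∑ (a + suc b) f                              ≡⟨ cong (λ n → ∑ n f) (+-suc a b) ⟩
    ∑ (a + b) f + f (a + b)                      ≡⟨ cong (_+ f (a + b)) (∑-+ a b f) ⟩
    ∑ a f + ∑ b (λ j → f (a + j)) + f (a + b)    ≡⟨ +-assoc (∑ a f) _ _ ⟩
    ∑ a f + (∑ b (λ j → f (a + j)) + f (a + b)) ∎
    where open ≡-Reasoning

  ∑-suc : ∀ n f → ∑ (suc n) f ≡ f 0 + ∑ n (f ∘ suc)
  ∑-suc n f = ∑-+ 1 n f

  ∑-swap : ∀ n m (f : ℕ → ℕ → ℕ) → ∑ n (λ i → ∑ m (f i)) ≡ ∑ m (λ j → ∑ n (λ i → f i j))
  ∑-swap zero    m f = sym (∑-zero m (λ _ _ → refl))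
  ∑-swap (suc n) m f = trans (cong (_+ ∑ m (f n)) (∑-swap n m f))
    (sym (∑-distrib-+ m (λ j → ∑ n (λ i → f i j)) (f n)))

  ∑-monoˡ-≤ : ∀ {n m} f → n ≤ m → ∑ n f ≤ ∑ m f
  ∑-monoˡ-≤ {n} {m} f n≤m = subst (λ k → ∑ n f ≤ ∑ k f) (m+[n∸m]≡n n≤m)
    (subst (∑ n f ≤_) (sym (∑-+ n (m ∸ n) f)) (m≤m+n (∑ n f) _))

  f≤∑ : ∀ n f {i} → i < n → f i ≤ ∑ n f
  f≤∑ (suc n) f {i} i<1+n with i ≟ n
  ... | yes refl = m≤n+m (f i) (∑ n f)
  ... | no i≢n   = ≤-trans (f≤∑ n f (≤∧≢⇒< (≤-pred i<1+n) i≢n)) (m≤m+n (∑ n f) (f n))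

  triangle : ℕ → ℕ
  triangle K = ∑ (suc K) (λ k → k)

  n≤triangle : ∀ n → n ≤ triangle n
  n≤triangle n = f≤∑ (suc n) (λ k → k) (n<1+n n)

  2*triangle : ∀ K → 2 * triangle K ≡ K * suc K
  2*triangle zero    = refl
  2*triangle (suc K) = trans (*-distribˡ-+ 2 (triangle K) (suc K)) (trans (cong (_+ 2 * suc K) (2*triangle K))
    (solve 1 (λ K → K :* (con 1 :+ K) :+ con 2 :* (con 1 :+ K) := (con 1 :+ K) :* (con 2 :+ K)) refl K))

module PairCounting where

  open import Defs using (countPairs; oneTo; totalCount)
  open import Data.Bool using (Bool; true; false)
  import Data.Bool as Bool
  open import Data.List using (List; []; _∷_; map; filter; upTo; length; applyUpTo; _∷ʳ_)
  open import Data.List.Properties using (applyUpTo-∷ʳ; map-upTo; map-∘)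
  open import Data.Nat.Base
  open import Data.Nat.Properties
  open import Data.Nat.DivMod using (m≡m%n+[m/n]*n; m%n<n; m/n*n≤m)
  open import Data.Nat.Divisibility using (_∣_; _∣?_; ∣m+n∣m⇒∣n; ∣m∣n⇒∣m+n; ∣⇒≤; m∣m*n; ∣-refl; divides)
  open import Data.Nat.ListAction using (sum)
  open import Data.Nat.ListAction.Properties using (sum-++)
  open import Data.Nat.Solver using (module +-*-Solver)
  open +-*-Solver
  open import Function using (_∘_)
  open import Relation.Binary.PropositionalEquality
  open import Relation.Nullary using (does; yes; no; ¬_)
  open import Relation.Nullary.Decidable using (dec-true; dec-false)
  open FiniteSums

  χ : Bool → ℕ
  χ true  = 1
  χ false = 0

  sum-applyUpTo : ∀ f n → sum (applyUpTo f n) ≡ ∑ n f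
  sum-applyUpTo f zero    = refl
  sum-applyUpTo f (suc n) = begin
    sum (applyUpTo f (suc n))          ≡⟨ cong sum (applyUpTo-∷ʳ f n) ⟨
    sum (applyUpTo f n ∷ʳ f n)         ≡⟨ sum-++ (applyUpTo f n) (f n ∷ []) ⟩
    sum (applyUpTo f n) + (f n + 0)    ≡⟨ cong₂ _+_ (sum-applyUpTo f n) (+-identityʳ (f n)) ⟩
    ∑ n f + f n ∎
    where open ≡-Reasoning

  sum-map-oneTo : ∀ h n → sum (map h (oneTo n)) ≡ ∑ n (h ∘ suc)
  sum-map-oneTo h n = begin
    sum (map h (map suc (upTo n)))   ≡⟨ cong sum (map-∘ (upTo n)) ⟨
    sum (map (h ∘ suc) (upTo n))     ≡⟨ cong sum (map-upTo (h ∘ suc) n) ⟩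
    sum (applyUpTo (h ∘ suc) n)      ≡⟨ sum-applyUpTo (h ∘ suc) n ⟩
    ∑ n (h ∘ suc) ∎
    where open ≡-Reasoning

  length-filter-true : ∀ {A : Set} (p : A → Bool) xs → length (filter (λ x → p x Bool.≟ true) xs) ≡ sum
      (map (χ ∘ p) xs)
  length-filter-true p []       = refl
  length-filter-true p (x ∷ xs) with p x
  ... | true  = cong suc (length-filter-true p xs)
  ... | false = length-filter-true p xs

  countPairs≡∑ : ∀ P X → countPairs P X ≡ ∑ X (λ i → ∑ (suc i) (λ j → χ (P (suc j) (suc i))))
  countPairs≡∑ P X = trans (sum-map-oneTo _ X) (∑-cong X λ i _ →
    trans (length-filter-true (λ m → P m (suc i)) (oneTo (suc i))) (sum-map-oneTo (λ m → χ (P m (suc i))) (suc i)))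

  totalCount≡triangle : ∀ X → totalCount X ≡ triangle X
  totalCount≡triangle X = begin
    totalCount X                        ≡⟨ countPairs≡∑ _ X ⟩
    ∑ X (λ i → ∑ (suc i) (λ _ → 1))     ≡⟨ ∑-cong X (λ i _ → trans (∑-const (suc i) 1) (*-identityʳ (suc i))) ⟩
    ∑ X suc                             ≡⟨ ∑-suc X (λ k → k) ⟨
    triangle X ∎
    where open ≡-Reasoning

  multipleOf : ℕ → ℕ → ℕ
  multipleOf d n = χ (does (d ∣? n))

  multipleOf-∣ : ∀ {d n} → d ∣ n → multipleOf d n ≡ 1
  multipleOf-∣ {d} {n} d∣n = cong χ (dec-true (d ∣? n) d∣n)

  multipleOf-∤ : ∀ {d n} → ¬ d ∣ n → multipleOf d n ≡ 0
  multipleOf-∤ {d} {n} d∤n = cong χ (dec-false (d ∣? n) d∤n)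

  private
    ∤-small : ∀ {d j} → 0 < j → j < d → ¬ d ∣ j
    ∤-small {d} {suc j} _ j<d d∣j = <⇒≱ j<d (∣⇒≤ d∣j)

    ∤-d*k+small : ∀ {d k j} → 0 < j → j < d → ¬ d ∣ d * k + j
    ∤-d*k+small 0<j j<d d∣ = ∤-small 0<j j<d (∣m+n∣m⇒∣n d∣ (m∣m*n _))

  ∑-multipleOf-window : ∀ d a → ∑ (suc d) (λ j → multipleOf (suc d) (a + j)) ≡ 1
  ∑-multipleOf-window d zero = trans (∑-suc d (multipleOf (suc d)))
    (cong₂ _+_ (multipleOf-∣ {suc d} {0} (divides 0 refl))
        (∑-zero d (λ j j<d → multipleOf-∤ (∤-small z<s (s≤s j<d)))))
  ∑-multipleOf-window d (suc a) = begin
    ∑ n (λ j → multipleOf n (suc a + j))   ≡⟨ ∑-cong n (λ j _ → cong (multipleOf n) (sym (+-suc a j))) ⟩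
    ∑ n (f ∘ suc)                          ≡⟨ +-cancelʳ-≡ _ _ _ shifted ⟩
    ∑ n f                                  ≡⟨ ∑-multipleOf-window d a ⟩
    1 ∎
    where
    open ≡-Reasoning
    n = suc d
    f : ℕ → ℕ
    f j = multipleOf n (a + j)
    f[n]≡f[0] : f n ≡ f 0
    f[n]≡f[0] with n ∣? a
    ... | yes n∣a = trans (multipleOf-∣ (∣m∣n⇒∣m+n n∣a ∣-refl))
        (sym (multipleOf-∣ (subst (n ∣_) (sym (+-identityʳ a)) n∣a)))
    ... | no n∤a  = trans (multipleOf-∤ (λ n∣a+n → n∤a (∣m+n∣m⇒∣n (subst (n ∣_) (+-comm a n) n∣a+n) ∣-refl)))
                          (sym (multipleOf-∤ (λ n∣a+0 → n∤a (subst (n ∣_) (+-identityʳ a) n∣a+0))))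
    shifted : ∑ n (f ∘ suc) + f 0 ≡ ∑ n f + f 0
    shifted = trans (+-comm (∑ n (f ∘ suc)) (f 0)) (trans (sym (∑-suc n f)) (cong (∑ n f +_) f[n]≡f[0]))

  multiplesBelow : ℕ → ℕ → ℕ → ℕ
  multiplesBelow d s M = ∑ M (λ j → multipleOf d (s + j))

  multiplesBelow-block : ∀ d s k → multiplesBelow (suc d) s (suc d * k) ≡ k
  multiplesBelow-block d s zero    = cong (multiplesBelow (suc d) s) (*-zeroʳ d)
  multiplesBelow-block d s (suc k) = begin
    multiplesBelow n s (n * suc k)
      ≡⟨ cong (multiplesBelow n s) (trans (*-suc n k) (+-comm n (n * k))) ⟩
    multiplesBelow n s (n * k + n)
      ≡⟨ ∑-+ (n * k) n _ ⟩
    multiplesBelow n s (n * k) + ∑ n (λ j → multipleOf n (s + (n * k + j)))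
      ≡⟨ cong₂ _+_ (multiplesBelow-block d s k) (∑-cong n (λ j _ → cong (multipleOf n) (+-comm-middle j))) ⟩
    k + ∑ n (λ j → multipleOf n ((n * k + s) + j))
      ≡⟨ cong (k +_) (∑-multipleOf-window d (n * k + s)) ⟩
    k + 1
      ≡⟨ +-comm k 1 ⟩
    suc k ∎
    where
    open ≡-Reasoning
    n = suc d
    +-comm-middle : ∀ j → s + (n * k + j) ≡ (n * k + s) + j
    +-comm-middle j = solve 3 (λ a j s → s :+ (a :+ j) := (a :+ s) :+ j) refl (n * k) j s

  -- The pairs j < M < N with d ∣ M and d ∣ s + j; for m = j + 1, the shifts s = 0 and s = 2
  -- select d ∣ m - 1 and d ∣ m + 1.
  pairsWithDivisor : ℕ → ℕ → ℕ → ℕ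
  pairsWithDivisor d s N = ∑ N (λ M → multipleOf d M * multiplesBelow d s M)

  pairsWithDivisor-suc : ∀ d s X →
    ∑ X (λ i → multipleOf d (suc i) * multiplesBelow d s (suc i)) ≡ pairsWithDivisor d s (suc X)
  pairsWithDivisor-suc d s X =
    sym (trans (∑-suc X _) (cong (_+ ∑ X (λ i → multipleOf d (suc i) * multiplesBelow d s (suc i)))
        (*-zeroʳ (multipleOf d 0))))

  pairsWithDivisor-block : ∀ d s K → pairsWithDivisor (suc d) s (suc d * K) ≡ ∑ K (λ k → k)
  pairsWithDivisor-block d s zero    = cong (pairsWithDivisor (suc d) s) (*-zeroʳ d)
  pairsWithDivisor-block d s (suc K) = begin
    P (n * suc K)
      ≡⟨ cong P (trans (*-suc n K) (+-comm n (n * K))) ⟩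
    P (n * K + n)
      ≡⟨ ∑-+ (n * K) n _ ⟩
    P (n * K) + ∑ n (λ j → g (n * K + j))
      ≡⟨ cong₂ _+_ (pairsWithDivisor-block d s K) (∑-suc d (λ j → g (n * K + j))) ⟩
    ∑ K (λ k → k) + (g (n * K + 0) + ∑ d (λ j → g (n * K + suc j)))
      ≡⟨ cong (λ r → ∑ K (λ k → k) + (g (n * K + 0) + r))
           (∑-zero d (λ j j<d → cong (_* multiplesBelow n s (n * K + suc j))
               (multipleOf-∤ (∤-d*k+small {n} {K} z<s (s≤s j<d))))) ⟩
    ∑ K (λ k → k) + (g (n * K + 0) + 0)
      ≡⟨ cong (λ r → ∑ K (λ k → k) + r) g[n*K]≡K ⟩
    ∑ K (λ k → k) + K ∎
    where
    open ≡-Reasoning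
    n = suc d
    P = pairsWithDivisor n s
    g : ℕ → ℕ
    g M = multipleOf n M * multiplesBelow n s M
    g[n*K]≡K : g (n * K + 0) + 0 ≡ K
    g[n*K]≡K rewrite +-identityʳ (n * K) | +-identityʳ (g (n * K))
                   | multipleOf-∣ {n} {n * K} (m∣m*n K) | multiplesBelow-block d s K = +-identityʳ K

  pairsWithDivisor-upper : ∀ d s X → pairsWithDivisor (suc d) s (suc X) ≤ triangle (X / suc d)
  pairsWithDivisor-upper d s X = begin
    pairsWithDivisor n s (suc X)         ≤⟨ ∑-monoˡ-≤ _ 1+X≤n*[1+K] ⟩
    pairsWithDivisor n s (n * suc K)     ≡⟨ pairsWithDivisor-block d s (suc K) ⟩
    triangle K ∎
    where
    open ≤-Reasoning
    n = suc d
    K = X / n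
    1+X≤n*[1+K] : suc X ≤ n * suc K
    1+X≤n*[1+K] = begin
      suc X              ≡⟨ cong suc (m≡m%n+[m/n]*n X n) ⟩
      suc (X % n + K * n) ≤⟨ +-monoˡ-≤ (K * n) (m%n<n X n) ⟩
      n + K * n          ≡⟨ cong (n +_) (*-comm K n) ⟩
      n + n * K          ≡⟨ *-suc n K ⟨
      n * suc K ∎

  pairsWithDivisor-lower : ∀ X → triangle (X / 2) ≤ pairsWithDivisor 2 0 (suc X)
  pairsWithDivisor-lower X = begin
    triangle K
      ≡⟨ cong₂ _+_ (pairsWithDivisor-block 1 0 K) last≡K ⟨
    pairsWithDivisor 2 0 (2 * K) + multipleOf 2 (2 * K) * multiplesBelow 2 0 (2 * K)
      ≡⟨⟩
    pairsWithDivisor 2 0 (suc (2 * K))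
      ≤⟨ ∑-monoˡ-≤ _ (s≤s (subst (_≤ X) (*-comm K 2) (m/n*n≤m X 2))) ⟩
    pairsWithDivisor 2 0 (suc X) ∎
    where
    open ≤-Reasoning
    K = X / 2
    last≡K : multipleOf 2 (2 * K) * multiplesBelow 2 0 (2 * K) ≡ K
    last≡K rewrite multipleOf-∣ {2} {2 * K} (m∣m*n K) | multiplesBelow-block 1 0 K = +-identityʳ K

module SieveEstimate where

  open import Data.Nat.Base
  open import Data.Nat.Properties
  open import Data.Nat.DivMod using (m/n*n≤m)
  open import Data.Nat.Solver using (module +-*-Solver)
  open +-*-Solver
  open import Data.Sum using (inj₁; inj₂)
  open import Relation.Binary.PropositionalEquality
  open FiniteSums

  oddDivisor : ℕ → ℕ
  oddDivisor l = suc (suc l * 2)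

  module _ (X : ℕ) where

    private
      K : ℕ → ℕ
      K l = X / oddDivisor l

      S₂ : ℕ → ℕ
      S₂ L = ∑ L (λ l → K l * K l)

      oddDivisor*K≤X : ∀ l → oddDivisor l * K l ≤ X
      oddDivisor*K≤X l = subst (_≤ X) (*-comm (K l) (oddDivisor l)) (m/n*n≤m X (oddDivisor l))

      4[1+l][2+l]K²≤X² : ∀ l → 4 * (suc l * (2 + l)) * (K l * K l) ≤ X * X
      4[1+l][2+l]K²≤X² l = begin
        4 * (suc l * (2 + l)) * (K l * K l)
          ≤⟨ *-monoˡ-≤ (K l * K l) (m≤m+n (4 * (suc l * (2 + l))) 1) ⟩
        (4 * (suc l * (2 + l)) + 1) * (K l * K l)
          ≡⟨ solve 2 (λ l k → (con 4 :* ((con 1 :+ l) :* (con 2 :+ l)) :+ con 1) :* (k :* k)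
            := ((con 1 :+ (con 1 :+ l) :* con 2) :* k) :* ((con 1 :+ (con 1 :+ l) :* con 2) :* k)) refl l (K l) ⟩
        (oddDivisor l * K l) * (oddDivisor l * K l)
          ≤⟨ *-mono-≤ (oddDivisor*K≤X l) (oddDivisor*K≤X l) ⟩
        X * X ∎
        where open ≤-Reasoning

      -- (2l + 3)² > 4(l + 1)(l + 2), and ∑_{l<L} 1/((l + 1)(l + 2)) = L/(L + 1) telescopes.
      telescoped : ∀ L → 4 * suc L * S₂ L ≤ L * (X * X)
      telescoped zero    = z≤n
      telescoped (suc L) = *-cancelˡ-≤ (suc L) (begin
        suc L * (4 * (2 + L) * (S + a))
          ≡⟨ solve 3 (λ L S a → (con 1 :+ L) :* (con 4 :* (con 2 :+ L) :* (S :+ a))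
               := (con 2 :+ L) :* (con 4 :* (con 1 :+ L) :* S) :+ con 4 :* ((con 1 :+ L) :* (con 2 :+ L)) :* a)
               refl L S a ⟩
        (2 + L) * (4 * suc L * S) + 4 * (suc L * (2 + L)) * a
          ≤⟨ +-mono-≤ (*-monoʳ-≤ (2 + L) (telescoped L)) (4[1+l][2+l]K²≤X² L) ⟩
        (2 + L) * (L * (X * X)) + X * X
          ≡⟨ solve 2 (λ L Y → (con 2 :+ L) :* (L :* Y) :+ Y := (con 1 :+ L) :* ((con 1 :+ L) :* Y)) refl L (X * X) ⟩
        suc L * (suc L * (X * X)) ∎)
        where
        open ≤-Reasoning
        S = S₂ L
        a = K L * K L

    4*∑K²≤X² : ∀ L → 4 * ∑ L (λ l → K l * K l) ≤ X * X
    4*∑K²≤X² L = *-cancelˡ-≤ (suc L) (begin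
      suc L * (4 * S₂ L)
        ≡⟨ solve 2 (λ L S → (con 1 :+ L) :* (con 4 :* S) := con 4 :* (con 1 :+ L) :* S) refl L (S₂ L) ⟩
      4 * suc L * S₂ L
        ≤⟨ telescoped L ⟩
      L * (X * X)
        ≤⟨ *-monoˡ-≤ (X * X) (n≤1+n L) ⟩
      suc L * (X * X) ∎)
      where open ≤-Reasoning

  8*n≤n*n+64 : ∀ n → 8 * n ≤ n * n + 64
  8*n≤n*n+64 n with ≤-total 8 n
  ... | inj₁ 8≤n = ≤-trans (*-monoˡ-≤ n 8≤n) (m≤m+n (n * n) 64)
  ... | inj₂ n≤8 = ≤-trans (*-monoʳ-≤ 8 n≤8) (m≤n+m 64 (n * n))

  triangle+triangle : ∀ n → triangle n + triangle n ≡ n * n + n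
  triangle+triangle n = begin
    triangle n + triangle n   ≡⟨ solve 1 (λ t → t :+ t := con 2 :* t) refl (triangle n) ⟩
    2 * triangle n            ≡⟨ 2*triangle n ⟩
    n * suc n                 ≡⟨ *-suc n n ⟩
    n + n * n                 ≡⟨ +-comm n (n * n) ⟩
    n * n + n ∎
    where open ≡-Reasoning

  32*triangle[X/2] : ∀ X → 32 * triangle (X / 2) ≤ 4 * (X * (X + 2))
  32*triangle[X/2] X = begin
    32 * triangle K
      ≡⟨ trans (*-assoc 16 2 (triangle K)) (cong (16 *_) (2*triangle K)) ⟩
    16 * (K * suc K)
      ≡⟨ solve 1 (λ K → con 16 :* (K :* (con 1 :+ K)) := con 4 :* ((con 2 :* K) :* (con 2 :* K :+ con 2))) refl K ⟩
    4 * ((2 * K) * (2 * K + 2))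
      ≤⟨ *-monoʳ-≤ 4 (*-mono-≤ 2K≤X (+-monoˡ-≤ 2 2K≤X)) ⟩
    4 * (X * (X + 2)) ∎
    where
    open ≤-Reasoning
    K = X / 2
    2K≤X : 2 * K ≤ X
    2K≤X = subst (_≤ X) (*-comm K 2) (m/n*n≤m X 2)

  sieveBound : ℕ → ℕ
  sieveBound X = 1 + triangle (X / 2) + ∑ X (λ l → triangle (X / oddDivisor l) + triangle (X / oddDivisor l))

  32*∑triangles : ∀ X → 32 * ∑ X (λ l → triangle (X / oddDivisor l) + triangle (X / oddDivisor l))
                        ≤ 9 * (X * X) + 256 * X
  32*∑triangles X = begin
    32 * ∑ X (λ l → triangle (K l) + triangle (K l))
      ≡⟨ cong (32 *_) (trans (∑-cong X (λ l _ → triangle+triangle (K l)))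
        (∑-distrib-+ X (λ l → K l * K l) K)) ⟩
    32 * (S₂ + S₁)
      ≡⟨ solve 2 (λ a b → con 32 :* (a :+ b) := con 32 :* a :+ con 4 :* (con 8 :* b)) refl S₂ S₁ ⟩
    32 * S₂ + 4 * (8 * S₁)
      ≤⟨ +-monoʳ-≤ (32 * S₂) (*-monoʳ-≤ 4 8S₁≤S₂+64X) ⟩
    32 * S₂ + 4 * (S₂ + X * 64)
      ≡⟨ solve 2 (λ s x → con 32 :* s :+ con 4 :* (s :+ x :* con 64) := con 9 :* (con 4 :* s) :+ con 256 :* x)
           refl S₂ X ⟩
    9 * (4 * S₂) + 256 * X
      ≤⟨ +-monoˡ-≤ (256 * X) (*-monoʳ-≤ 9 (4*∑K²≤X² X X)) ⟩
    9 * (X * X) + 256 * X ∎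
    where
    open ≤-Reasoning
    K : ℕ → ℕ
    K l = X / oddDivisor l
    S₂ = ∑ X (λ l → K l * K l)
    S₁ = ∑ X K
    8S₁≤S₂+64X : 8 * S₁ ≤ S₂ + X * 64
    8S₁≤S₂+64X = begin
      8 * S₁                            ≡⟨ ∑-*ˡ X 8 K ⟨
      ∑ X (λ l → 8 * K l)               ≤⟨ ∑-mono-≤ X (λ l _ → 8*n≤n*n+64 (K l)) ⟩
      ∑ X (λ l → K l * K l + 64)        ≡⟨ ∑-distrib-+ X (λ l → K l * K l) (λ _ → 64) ⟩
      S₂ + ∑ X (λ _ → 64)               ≡⟨ cong (S₂ +_) (∑-const X 64) ⟩
      S₂ + X * 64 ∎

  18*sieveBound≤17*triangle : ∀ X → 1000 ≤ X → 18 * sieveBound X ≤ 17 * triangle X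
  18*sieveBound≤17*triangle X 1000≤X = *-cancelˡ-≤ 16 (begin
    16 * (18 * sieveBound X)
      ≡⟨ solve 2 (λ t s → con 16 :* (con 18 :* ((con 1 :+ t) :+ s))
        := con 9 :* (con 32 :+ con 32 :* t :+ con 32 :* s)) refl (triangle (X / 2)) Σ ⟩
    9 * (32 + 32 * triangle (X / 2) + 32 * Σ)
      ≤⟨ *-monoʳ-≤ 9 (+-mono-≤ (+-monoʳ-≤ 32 (32*triangle[X/2] X)) (32*∑triangles X)) ⟩
    9 * (32 + 4 * (X * (X + 2)) + (9 * (X * X) + 256 * X))
      ≡⟨ solve 1 (λ X → con 9 :* (con 32 :+ con 4 :* (X :* (X :+ con 2)) :+ (con 9 :* (X :* X) :+ con 256 :* X))
           := con 117 :* (X :* X) :+ con 136 :* X :+ (con 288 :+ con 2240 :* X)) refl X ⟩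
    117 * (X * X) + 136 * X + (288 + 2240 * X)
      ≤⟨ +-monoʳ-≤ (117 * (X * X) + 136 * X) lower-order ⟩
    117 * (X * X) + 136 * X + 19 * (X * X)
      ≡⟨ solve 1 (λ X → con 117 :* (X :* X) :+ con 136 :* X :+ con 19 :* (X :* X)
        := con 8 :* (con 17 :* (X :* (con 1 :+ X)))) refl X ⟩
    8 * (17 * (X * suc X))
      ≡⟨ cong (λ n → 8 * (17 * n)) (2*triangle X) ⟨
    8 * (17 * (2 * triangle X))
      ≡⟨ solve 1 (λ t → con 8 :* (con 17 :* (con 2 :* t)) := con 16 :* (con 17 :* t)) refl (triangle X) ⟩
    16 * (17 * triangle X) ∎)
    where
    open ≤-Reasoning
    Σ = ∑ X (λ l → triangle (X / oddDivisor l) + triangle (X / oddDivisor l))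
    lower-order : 288 + 2240 * X ≤ 19 * (X * X)
    lower-order = begin
      288 + 2240 * X
        ≤⟨ +-monoˡ-≤ (2240 * X) (≤-trans (m≤m+n 288 16472) (*-monoʳ-≤ 16760 (≤-trans (s≤s z≤n) 1000≤X))) ⟩
      16760 * X + 2240 * X
        ≡⟨ solve 1 (λ X → con 16760 :* X :+ con 2240 :* X := con 19 :* (con 1000 :* X)) refl X ⟩
      19 * (1000 * X)
        ≤⟨ *-monoʳ-≤ 19 (*-monoˡ-≤ X 1000≤X) ⟩
      19 * (X * X) ∎

module SignCounts where

  open import Defs using (bias; posCount; negCount)
  open import Data.Integer as ℤ using (+_)
  open import Data.Nat.Base
  open import Data.Nat.Properties hiding (_<?_)
  open import Data.Nat.Divisibility using (_∣_; _∣?_; ∣-trans; ∣⇒≤; ∣m+n∣m⇒∣n; ∣m∣n⇒∣m+n; ∣-refl)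
  open import Data.Nat.GCD using (gcd; gcd[m,n]∣m; gcd[m,n]∣n)
  open import Data.Product using (∃; _×_; _,_)
  open import Data.Rational using (0ℚ) renaming (_<_ to _<ℚ_)
  open import Data.Rational.Properties using (_<?_)
  open import Data.Sum using (_⊎_; inj₁; inj₂)
  open import Data.Nat.Solver using (module +-*-Solver)
  open import Function.Bundles using (Equivalence)
  open import Relation.Binary.PropositionalEquality
  open import Relation.Nullary using (does; yes; no; contradiction)
  open import Relation.Nullary.Decidable using (dec-true)
  open Divisors
  open LocalFactors
  open FiniteSums
  open PairCounting
  open SieveEstimate

  private
    χ-pos χ-neg : ℕ → ℕ → ℕ
    χ-pos j i = χ (does (0ℚ <? bias (+ suc j) (suc i)))
    χ-neg j i = χ (does (bias (+ suc j) (suc i) <? 0ℚ))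

  0<bias-if-even : ∀ {i j} → 2 ∣ suc i → 2 ∣ j → 0ℚ <ℚ bias (+ suc j) (suc i)
  0<bias-if-even {i} {j} 2∣M 2∣j = Equivalence.from (0<bias⇔0<biasNumerator (+ suc j) {suc i} (s≤s z≤n))
    (biasNumerator-pos {j} {suc j} {suc j + 1} {suc i}
      (common-divisor⇒gcd≢1 (λ ()) 2∣j 2∣M)
      (common-divisor⇒gcd≢1 (λ ()) (subst (2 ∣_) (+-suc j 1) (∣m∣n⇒∣m+n 2∣j ∣-refl)) 2∣M))

  triangle[X/2]≤posCount : ∀ X → triangle (X / 2) ≤ posCount X
  triangle[X/2]≤posCount X = begin
    triangle (X / 2)
      ≤⟨ pairsWithDivisor-lower X ⟩
    pairsWithDivisor 2 0 (suc X)
      ≡⟨ pairsWithDivisor-suc 2 0 X ⟨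
    ∑ X (λ i → multipleOf 2 (suc i) * multiplesBelow 2 0 (suc i))
      ≡⟨ ∑-cong X (λ i _ → ∑-*ˡ (suc i) (multipleOf 2 (suc i)) (multipleOf 2)) ⟨
    ∑ X (λ i → ∑ (suc i) (λ j → multipleOf 2 (suc i) * multipleOf 2 j))
      ≤⟨ ∑-mono-≤ X (λ i _ → ∑-mono-≤ (suc i) (λ j _ → even-pair i j)) ⟩
    ∑ X (λ i → ∑ (suc i) (λ j → χ-pos j i))
      ≡⟨ countPairs≡∑ _ X ⟨
    posCount X ∎
    where
    open ≤-Reasoning
    even-pair : ∀ i j → multipleOf 2 (suc i) * multipleOf 2 j ≤ χ-pos j i
    even-pair i j with 2 ∣? suc i | 2 ∣? j
    ... | yes 2∣M | yes 2∣j = ≤-reflexive (trans (cong₂ _*_ (multipleOf-∣ 2∣M) (multipleOf-∣ 2∣j))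
                                (cong χ (sym (dec-true (0ℚ <? bias (+ suc j) (suc i)) (0<bias-if-even 2∣M 2∣j)))))
    ... | no 2∤M  | _       = ≤-trans (≤-reflexive (cong (_* multipleOf 2 j) (multipleOf-∤ 2∤M))) z≤n
    ... | yes _   | no 2∤j  = ≤-trans (≤-reflexive (trans (cong (multipleOf 2 (suc i) *_) (multipleOf-∤ 2∤j))
                                (*-zeroʳ (multipleOf 2 (suc i))))) z≤n

  small-common-divisor : ∀ {X y M} → M ≢ 0 → M ≤ X → gcd y M ≢ 1 →
    (2 ∣ y × 2 ∣ M) ⊎ ∃ λ l → l < X × oddDivisor l ∣ y × oddDivisor l ∣ M
  small-common-divisor {X} {y} {M} M≢0 M≤X gcd≢1 with even⊎odd (gcd y M)
  ... | inj₁ 2∣g          = inj₁ (∣-trans 2∣g (gcd[m,n]∣m y M) , ∣-trans 2∣g (gcd[m,n]∣n y M))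
  ... | inj₂ (zero , g≡1) = contradiction g≡1 gcd≢1
  ... | inj₂ (suc l , g≡o) = inj₂ (l , l<X , subst (_∣ y) g≡o (gcd[m,n]∣m y M) , o∣M)
    where
    o∣M : oddDivisor l ∣ M
    o∣M = subst (_∣ M) g≡o (gcd[m,n]∣n y M)
    l<X : l < X
    l<X = <-≤-trans (s≤s (≤-trans (n≤1+n l) (m≤m*n (suc l) 2))) (≤-trans (∣⇒≤ {{≢-nonZero M≢0}} o∣M) M≤X)

  -- Indexed by m = j + 1.  The divisor 2 is tested on m - 1 only: m + 1 has the same parity.
  sieveWeight : ℕ → ℕ → ℕ → ℕ
  sieveWeight X M j = multipleOf 2 M * multipleOf 2 j
    + ∑ X (λ l → multipleOf (oddDivisor l) M * (multipleOf (oddDivisor l) j + multipleOf (oddDivisor l) (2 + j)))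

  sieved : ∀ {X M j y} → M ≢ 0 → M ≤ X → y ≡ j ⊎ y ≡ 2 + j → gcd y M ≢ 1 → 1 ≤ sieveWeight X M j
  sieved {X} {M} {j} {y} M≢0 M≤X y≡ gcd≢1 with small-common-divisor M≢0 M≤X gcd≢1
  ... | inj₁ (2∣y , 2∣M) = ≤-trans (≤-reflexive (sym (cong₂ _*_ (multipleOf-∣ 2∣M) (multipleOf-∣ (2∣j y≡ 2∣y)))))
      (m≤m+n _ _)
    where
    2∣j : y ≡ j ⊎ y ≡ 2 + j → 2 ∣ y → 2 ∣ j
    2∣j (inj₁ refl) 2∣y = 2∣y
    2∣j (inj₂ refl) 2∣y = ∣m+n∣m⇒∣n 2∣y ∣-refl
  ... | inj₂ (l , l<X , o∣y , o∣M) = ≤-trans (≤-trans 1≤f[l] (f≤∑ X f l<X)) (m≤n+m _ _)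
    where
    o = oddDivisor l
    f : ℕ → ℕ
    f k = multipleOf (oddDivisor k) M * (multipleOf (oddDivisor k) j + multipleOf (oddDivisor k) (2 + j))
    1≤residue : y ≡ j ⊎ y ≡ 2 + j → 1 ≤ multipleOf o j + multipleOf o (2 + j)
    1≤residue (inj₁ refl) = ≤-trans (≤-reflexive (sym (multipleOf-∣ o∣y))) (m≤m+n _ _)
    1≤residue (inj₂ refl) = ≤-trans (≤-reflexive (sym (multipleOf-∣ o∣y))) (m≤n+m _ _)
    1≤f[l] : 1 ≤ f l
    1≤f[l] = subst (λ k → 1 ≤ k * (multipleOf o j + multipleOf o (2 + j))) (sym (multipleOf-∣ o∣M))
      (subst (1 ≤_) (sym (+-identityʳ _)) (1≤residue y≡))

  -- The term χ (i ≡ᵇ 0) covers m = M = 1, where the bias vanishes.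
  bias<0-or-sieved : ∀ X i j → suc i ≤ X → 1 ≤ χ-neg j i + χ (i ≡ᵇ 0) + sieveWeight X (suc i) j
  bias<0-or-sieved X zero      j _   = ≤-trans (m≤n+m 1 (χ-neg j 0)) (m≤m+n (χ-neg j 0 + 1) (sieveWeight X 1 j))
  bias<0-or-sieved X (suc i) j M≤X with gcd j (2 + i) ≟ 1 | gcd (suc j + 1) (2 + i) ≟ 1
  ... | yes g₁≡1 | yes g₂≡1 = ≤-trans (≤-reflexive (sym negative≡1))
      (m≤m+n (χ-neg j (suc i) + 0) (sieveWeight X (2 + i) j))
    where
    negative≡1 : χ-neg j (suc i) + 0 ≡ 1
    negative≡1 = trans (+-identityʳ _) (cong χ (dec-true (bias (+ suc j) (2 + i) <? 0ℚ)
      (Equivalence.from (bias<0⇔biasNumerator<0 (+ suc j) {2 + i} (s≤s z≤n))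
        (biasNumerator-neg {j} {suc j} {suc j + 1} {2 + i} (s≤s (s≤s z≤n)) g₁≡1 g₂≡1))))
  ... | no g₁≢1 | _         = ≤-trans (sieved {X} {2 + i} {j} (λ ()) M≤X (inj₁ refl) g₁≢1)
      (m≤n+m (sieveWeight X (2 + i) j) (χ-neg j (suc i) + 0))
  ... | yes _   | no g₂≢1   = ≤-trans (sieved {X} {2 + i} {j} (λ ()) M≤X (inj₂ (cong suc (+-comm j 1))) g₂≢1)
      (m≤n+m (sieveWeight X (2 + i) j) (χ-neg j (suc i) + 0))

  ∑∑sieveWeight : ∀ X → ∑ X (λ i → ∑ (suc i) (sieveWeight X (suc i)))
                        ≤ triangle (X / 2) + ∑ X (λ l → triangle (X / oddDivisor l) + triangle (X / oddDivisor l))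
  ∑∑sieveWeight X = begin
    ∑ X (λ i → ∑ (suc i) (sieveWeight X (suc i)))
      ≡⟨ ∑-cong X (λ i _ → column i) ⟩
    ∑ X (λ i → a i + ∑ X (λ l → b l i + c l i))
      ≡⟨ ∑-distrib-+ X a _ ⟩
    ∑ X a + ∑ X (λ i → ∑ X (λ l → b l i + c l i))
      ≡⟨ cong (λ r → ∑ X a + r) (∑-swap X X (λ i l → b l i + c l i)) ⟩
    ∑ X a + ∑ X (λ l → ∑ X (λ i → b l i + c l i))
      ≡⟨ cong₂ _+_ (pairsWithDivisor-suc 2 0 X)
        (∑-cong X (λ l _ → trans (∑-distrib-+ X (b l) (c l))
        (cong₂ _+_ (pairsWithDivisor-suc (o l) 0 X) (pairsWithDivisor-suc (o l) 2 X)))) ⟩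
    pairsWithDivisor 2 0 (suc X) + ∑ X (λ l → pairsWithDivisor (o l) 0 (suc X) + pairsWithDivisor (o l) 2 (suc X))
      ≤⟨ +-mono-≤ (pairsWithDivisor-upper 1 0 X)
                  (∑-mono-≤ X (λ l _ → +-mono-≤ (pairsWithDivisor-upper (suc l * 2) 0 X)
                      (pairsWithDivisor-upper (suc l * 2) 2 X))) ⟩
    triangle (X / 2) + ∑ X (λ l → triangle (X / o l) + triangle (X / o l)) ∎
    where
    open ≤-Reasoning
    o = oddDivisor
    a : ℕ → ℕ
    a i = multipleOf 2 (suc i) * multiplesBelow 2 0 (suc i)
    b c : ℕ → ℕ → ℕ
    b l i = multipleOf (o l) (suc i) * multiplesBelow (o l) 0 (suc i)
    c l i = multipleOf (o l) (suc i) * multiplesBelow (o l) 2 (suc i)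
    column : ∀ i → ∑ (suc i) (sieveWeight X (suc i)) ≡ a i + ∑ X (λ l → b l i + c l i)
    column i = trans (∑-distrib-+ (suc i) _ _) (cong₂ _+_ (∑-*ˡ (suc i) (multipleOf 2 (suc i)) (multipleOf 2))
      (trans (∑-swap (suc i) X _) (∑-cong X (λ l _ →
        trans (∑-*ˡ (suc i) (multipleOf (o l) (suc i)) (λ j → multipleOf (o l) j + multipleOf (o l) (2 + j)))
          (trans (cong (multipleOf (o l) (suc i) *_)
              (∑-distrib-+ (suc i) (multipleOf (o l)) (λ j → multipleOf (o l) (2 + j))))
            (*-distribˡ-+ (multipleOf (o l) (suc i)) _ _))))))

  ∑∑origin≤1 : ∀ X → ∑ X (λ i → ∑ (suc i) (λ _ → χ (i ≡ᵇ 0))) ≤ 1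
  ∑∑origin≤1 zero    = z≤n
  ∑∑origin≤1 (suc X) = ≤-reflexive (trans (∑-suc X _)
      (cong (λ r → 1 + r) (∑-zero X (λ i _ → ∑-zero (2 + i) (λ _ _ → refl)))))

  triangle≤negCount+sieveBound : ∀ X → triangle X ≤ negCount X + sieveBound X
  triangle≤negCount+sieveBound X = begin
    triangle X
      ≡⟨ ∑-suc X (λ k → k) ⟩
    ∑ X suc
      ≡⟨ ∑-cong X (λ i _ → trans (∑-const (suc i) 1) (*-identityʳ (suc i))) ⟨
    ∑ X (λ i → ∑ (suc i) (λ _ → 1))
      ≤⟨ ∑-mono-≤ X (λ i i<X → ∑-mono-≤ (suc i) (λ j _ → bias<0-or-sieved X i j i<X)) ⟩
    ∑ X (λ i → ∑ (suc i) (λ j → χ-neg j i + χ (i ≡ᵇ 0) + sieveWeight X (suc i) j))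
      ≡⟨ ∑-cong X (λ i _ → trans (∑-distrib-+ (suc i) _ _) (cong (_+ W i) (∑-distrib-+ (suc i) _ _))) ⟩
    ∑ X (λ i → N i + Z i + W i)
      ≡⟨ trans (∑-distrib-+ X _ W) (cong (_+ ∑ X W) (∑-distrib-+ X N Z)) ⟩
    ∑ X N + ∑ X Z + ∑ X W
      ≤⟨ +-mono-≤ (+-mono-≤ (≤-reflexive (sym (countPairs≡∑ _ X))) (∑∑origin≤1 X)) (∑∑sieveWeight X) ⟩
    negCount X + 1 + (triangle (X / 2) + ∑triangles)
      ≡⟨ solve 4 (λ n a b c → n :+ a :+ (b :+ c) := n :+ (a :+ b :+ c)) refl (negCount X) 1 (triangle (X / 2))
          ∑triangles ⟩
    negCount X + sieveBound X ∎
    where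
    open ≤-Reasoning
    open +-*-Solver
    N Z W : ℕ → ℕ
    N i = ∑ (suc i) (λ j → χ-neg j i)
    Z i = ∑ (suc i) (λ _ → χ (i ≡ᵇ 0))
    W i = ∑ (suc i) (sieveWeight X (suc i))
    ∑triangles = ∑ X (λ l → triangle (X / oddDivisor l) + triangle (X / oddDivisor l))

  triangle≤18*negCount : ∀ X → 1000 ≤ X → triangle X ≤ 18 * negCount X
  triangle≤18*negCount X 1000≤X = +-cancelˡ-≤ (17 * triangle X) (triangle X) (18 * negCount X) (begin
    17 * triangle X + triangle X
      ≡⟨ +-comm (17 * triangle X) (triangle X) ⟩
    18 * triangle X
      ≤⟨ *-monoʳ-≤ 18 (triangle≤negCount+sieveBound X) ⟩
    18 * (negCount X + sieveBound X)
      ≡⟨ *-distribˡ-+ 18 (negCount X) (sieveBound X) ⟩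
    18 * negCount X + 18 * sieveBound X
      ≤⟨ +-monoʳ-≤ (18 * negCount X) (18*sieveBound≤17*triangle X 1000≤X) ⟩
    18 * negCount X + 17 * triangle X
      ≡⟨ +-comm (18 * negCount X) (17 * triangle X) ⟩
    17 * triangle X + 18 * negCount X ∎)
    where open ≤-Reasoning

module LeibnizSeries where

  open import Defs using (leibniz; ι)
  open import Data.Integer as ℤ using (ℤ; +_; -[1+_])
  open import Data.Nat as ℕ using (ℕ; zero; suc)
  import Data.Nat.Properties as ℕ
  open import Data.Product using (Σ; _,_; proj₁; proj₂)
  open import Data.Rational using (ℚ; _/_; 0ℚ; 1ℚ; _+_; _*_; _-_; -_; _≤_)
  open import Data.Rational.Properties
  open import Function using (_∘_)
  open import Relation.Binary.PropositionalEquality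
  open import Relation.Nullary.Decidable using (toWitness)
  open RationalArithmetic
  open import Data.Rational.Solver using (module +-*-Solver)
  open +-*-Solver

  term : ℕ → ℚ
  term n = + 4 / suc (2 ℕ.* n)

  alternatingSign : ℕ → ℤ
  alternatingSign zero          = + 1
  alternatingSign (suc zero)    = -[1+ 0 ]
  alternatingSign (suc (suc n)) = alternatingSign n

  -- The sign used by leibniz is where-bound, hence lambda-lifted over the clause variable and
  -- impossible to name.  Unification names it: Δ and signed are solved from the equations below,
  -- the with in Δ≡signed abstracting that extra argument so that signed is a pattern solution.
  private
    increment : Σ (ℕ → ℚ) λ Δ → ∀ n → leibniz (suc n) ≡ leibniz n + Δ n
    increment = _ , λ _ → refl

    Δ : ℕ → ℚ
    Δ = proj₁ increment

    mutual
      signed : ℕ → ℕ → ℚ → ℚ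
      signed = _

      Δ≡signed : ∀ k → Δ (suc (suc k)) ≡ signed (suc (suc k)) k (term (suc (suc k)))
      Δ≡signed k with term (suc (suc k)) | suc (suc k)
      ... | _ | _ = refl

    signed≡ : ∀ a k w → signed a k w ≡ ι (alternatingSign k) * w
    signed≡ a zero          w = refl
    signed≡ a (suc zero)    w = refl
    signed≡ a (suc (suc k)) w = signed≡ a k w

    Δ≡ : ∀ n → Δ n ≡ ι (alternatingSign n) * term n
    Δ≡ zero          = refl
    Δ≡ (suc zero)    = refl
    Δ≡ (suc (suc k)) = trans (Δ≡signed k) (signed≡ (suc (suc k)) k (term (suc (suc k))))

  leibniz-suc : ∀ n → leibniz (suc n) ≡ leibniz n + ι (alternatingSign n) * term n
  leibniz-suc n = trans (proj₂ increment n) (cong (λ d → leibniz n + d) (Δ≡ n))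

  private
    alternatingSign-even : ∀ K → alternatingSign (2 ℕ.* K) ≡ + 1
    alternatingSign-even zero    = refl
    alternatingSign-even (suc K) = trans (cong alternatingSign (ℕ.*-suc 2 K)) (alternatingSign-even K)

    alternatingSign-odd : ∀ K → alternatingSign (suc (2 ℕ.* K)) ≡ -[1+ 0 ]
    alternatingSign-odd zero    = refl
    alternatingSign-odd (suc K) = trans (cong (alternatingSign ∘ suc) (ℕ.*-suc 2 K)) (alternatingSign-odd K)

    term-antimono : ∀ n → term (suc n) ≤ term n
    term-antimono n = cross-≤ 4 (suc (2 ℕ.* suc n)) 4 (suc (2 ℕ.* n))
        (ℕ.*-monoʳ-≤ 4 (ℕ.s≤s (ℕ.*-monoʳ-≤ 2 (ℕ.n≤1+n n))))

    even odd : ℕ → ℚ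
    even K = leibniz (2 ℕ.* K)
    odd  K = leibniz (suc (2 ℕ.* K))

    odd≡ : ∀ K → odd K ≡ even K + term (2 ℕ.* K)
    odd≡ K = begin
      odd K
        ≡⟨ leibniz-suc (2 ℕ.* K) ⟩
      even K + ι (alternatingSign (2 ℕ.* K)) * term (2 ℕ.* K)
        ≡⟨ cong (λ s → even K + ι s * term (2 ℕ.* K)) (alternatingSign-even K) ⟩
      even K + 1ℚ * term (2 ℕ.* K)
        ≡⟨ cong (λ t → even K + t) (*-identityˡ (term (2 ℕ.* K))) ⟩
      even K + term (2 ℕ.* K) ∎
      where open ≡-Reasoning

    even-suc≡ : ∀ K → even (suc K) ≡ odd K - term (suc (2 ℕ.* K))
    even-suc≡ K = begin
      even (suc K)
        ≡⟨ cong leibniz (ℕ.*-suc 2 K) ⟩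
      leibniz (suc (suc (2 ℕ.* K)))
        ≡⟨ leibniz-suc (suc (2 ℕ.* K)) ⟩
      odd K + ι (alternatingSign (suc (2 ℕ.* K))) * term (suc (2 ℕ.* K))
        ≡⟨ cong (λ s → odd K + ι s * term (suc (2 ℕ.* K))) (alternatingSign-odd K) ⟩
      odd K + ι -[1+ 0 ] * term (suc (2 ℕ.* K))
        ≡⟨ solve 2 (λ o t → o :+ con (ι -[1+ 0 ]) :* t := o :- t) refl (odd K) (term (suc (2 ℕ.* K))) ⟩
      odd K - term (suc (2 ℕ.* K)) ∎
      where open ≡-Reasoning

    even-mono : ∀ K → even K ≤ even (suc K)
    even-mono K = begin
      even K
        ≡⟨ +-identityʳ (even K) ⟨
      even K + 0ℚ
        ≤⟨ +-monoʳ-≤ (even K) (p≤q⇒0≤q-p (term-antimono (2 ℕ.* K))) ⟩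
      even K + (term (2 ℕ.* K) - term (suc (2 ℕ.* K)))
        ≡⟨ solve 3 (λ e a b → e :+ (a :- b) := (e :+ a) :- b) refl (even K) (term (2 ℕ.* K)) (term (suc (2 ℕ.* K))) ⟩
      (even K + term (2 ℕ.* K)) - term (suc (2 ℕ.* K))
        ≡⟨ cong (_- term (suc (2 ℕ.* K))) (odd≡ K) ⟨
      odd K - term (suc (2 ℕ.* K))
        ≡⟨ even-suc≡ K ⟨
      even (suc K) ∎
      where open ≤-Reasoning

    even-suc≤odd : ∀ K → even (suc K) ≤ odd K
    even-suc≤odd K = begin
      even (suc K)                   ≡⟨ even-suc≡ K ⟩
      odd K - term (suc (2 ℕ.* K))   ≤⟨ +-monoʳ-≤ (odd K) (neg-antimono-≤ (0≤a/b 4 (suc (2 ℕ.* suc (2 ℕ.* K))))) ⟩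
      odd K + - 0ℚ                   ≡⟨ +-identityʳ (odd K) ⟩
      odd K ∎
      where open ≤-Reasoning

    even-mono-+ : ∀ k K → even K ≤ even (k ℕ.+ K)
    even-mono-+ zero    K = ≤-refl
    even-mono-+ (suc k) K = ≤-trans (even-mono-+ k K) (even-mono (k ℕ.+ K))

  3≤leibniz[1+2K] : ∀ K → ι (+ 3) ≤ leibniz (suc (2 ℕ.* K))
  3≤leibniz[1+2K] 0 = toWitness {a? = ι (+ 3) ≤? leibniz 1} _
  3≤leibniz[1+2K] 1 = toWitness {a? = ι (+ 3) ≤? leibniz 3} _
  3≤leibniz[1+2K] 2 = toWitness {a? = ι (+ 3) ≤? leibniz 5} _
  3≤leibniz[1+2K] K@(suc (suc (suc k))) = begin
    ι (+ 3)              ≤⟨ toWitness {a? = ι (+ 3) ≤? leibniz 8} _ ⟩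
    even 4               ≤⟨ even-mono-+ k 4 ⟩
    even (k ℕ.+ 4)       ≡⟨ cong even (ℕ.+-comm k 4) ⟩
    even (suc K)         ≤⟨ even-suc≤odd K ⟩
    odd K ∎
    where open ≤-Reasoning

module Densities where

  open import Defs using (ι; posCount; negCount; totalCount; BelowInvTwoPiSq)
  open import Data.Integer as ℤ using (+_; -[1+_])
  open import Data.Nat as ℕ using (ℕ; zero; suc; _/_)
  import Data.Nat.Properties as ℕ
  open import Data.Nat.DivMod using (m≡m%n+[m/n]*n; m%n<n)
  import Data.Nat.Solver as ℕ-Solver
  open import Data.Product using (∃; _,_; map)
  open import Data.Rational using (ℚ; mkℚ; 0ℚ; 1ℚ; _+_; _*_; _-_; _≤_; _<_; positive; nonNegative)
    renaming (_/_ to _÷_)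
  open import Data.Rational.Properties
  open import Function.Bundles using (Equivalence)
  open import Relation.Binary.PropositionalEquality
  open import Relation.Nullary using (yes; no; contradiction)
  import Data.Rational.Solver as ℚ-Solver
  open RationalArithmetic
  open FiniteSums
  open PairCounting
  open SignCounts
  open LeibnizSeries

  archimedean : ∀ {r} → 0ℚ < r → ∃ λ d → + 1 ÷ suc d ≤ r
  archimedean {mkℚ (+ zero) _ _} 0<r with positive 0<r
  ... | ()
  archimedean {r@(mkℚ (+ suc a) d _)} _ = d , subst (+ 1 ÷ suc d ≤_) (↥p/↧p≡p r)
    (cross-≤ 1 (suc d) (suc a) (suc d) (ℕ.*-monoˡ-≤ (suc d) {1} {suc a} (ℕ.s≤s ℕ.z≤n)))
  archimedean {r@(mkℚ -[1+ _ ] _ _)} 0<r = contradiction (negative⁻¹ r) (<-asym 0<r)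

  d*triangle<4[1+d]*triangle[X/2] : ∀ d X → 2 ℕ.+ d ℕ.≤ X → d ℕ.* triangle X ℕ.< 4 ℕ.* suc d ℕ.* triangle (X / 2)
  d*triangle<4[1+d]*triangle[X/2] d (suc X-1) 2+d≤X = ℕ.*-cancelˡ-< 2 _ _ (begin-strict
    2 ℕ.* (d ℕ.* triangle X)
      ≡⟨ solve 2 (λ d t → con 2 :* (d :* t) := d :* (con 2 :* t)) refl d (triangle X) ⟩
    d ℕ.* (2 ℕ.* triangle X)
      ≡⟨ cong (d ℕ.*_) (2*triangle X) ⟩
    d ℕ.* (X ℕ.* suc X)
      ≡⟨ ℕ.*-assoc d X (suc X) ⟨
    d ℕ.* X ℕ.* suc X
      <⟨ ℕ.*-monoˡ-< (suc X) d*X<[1+d]*[X-1] ⟩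
    suc d ℕ.* X-1 ℕ.* suc X
      ≤⟨ ℕ.*-mono-≤ (ℕ.*-monoʳ-≤ (suc d) (ℕ.≤-pred X≤1+2K)) (ℕ.s≤s X≤1+2K) ⟩
    suc d ℕ.* (2 ℕ.* K) ℕ.* suc (1 ℕ.+ 2 ℕ.* K)
      ≡⟨ solve 2 (λ n k → n :* (con 2 :* k) :* (con 2 :+ con 2 :* k)
        := con 4 :* n :* (k :* (con 1 :+ k))) refl (suc d) K ⟩
    4 ℕ.* suc d ℕ.* (K ℕ.* suc K)
      ≡⟨ cong (4 ℕ.* suc d ℕ.*_) (2*triangle K) ⟨
    4 ℕ.* suc d ℕ.* (2 ℕ.* triangle K)
      ≡⟨ solve 2 (λ n t → con 4 :* n :* (con 2 :* t) := con 2 :* (con 4 :* n :* t)) refl (suc d) (triangle K) ⟩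
    2 ℕ.* (4 ℕ.* suc d ℕ.* triangle K) ∎)
    where
    open ℕ.≤-Reasoning
    open ℕ-Solver.+-*-Solver
    X = suc X-1
    K = X / 2
    X≤1+2K : X ℕ.≤ 1 ℕ.+ 2 ℕ.* K
    X≤1+2K = begin
      X                 ≡⟨ m≡m%n+[m/n]*n X 2 ⟩
      X ℕ.% 2 ℕ.+ K ℕ.* 2 ≤⟨ ℕ.+-mono-≤ (ℕ.≤-pred (m%n<n X 2)) (ℕ.≤-reflexive (ℕ.*-comm K 2)) ⟩
      1 ℕ.+ 2 ℕ.* K ∎
    d*X<[1+d]*[X-1] : d ℕ.* X ℕ.< suc d ℕ.* X-1
    d*X<[1+d]*[X-1] = begin-strict
      d ℕ.* X             ≡⟨ ℕ.*-suc d X-1 ⟩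
      d ℕ.+ d ℕ.* X-1     <⟨ ℕ.+-monoˡ-< (d ℕ.* X-1) (ℕ.≤-pred 2+d≤X) ⟩
      X-1 ℕ.+ d ℕ.* X-1 ∎

  posCount-beats : ∀ q d → + 1 ÷ suc d ≤ + 1 ÷ 4 - q →
                   ∀ X → 2 ℕ.+ d ℕ.≤ X → q * (+ totalCount X ÷ 1) < + posCount X ÷ 1
  posCount-beats q d 1/[1+d]≤¼-q X 2+d≤X = begin-strict
    q * (+ totalCount X ÷ 1)
      ≡⟨ cong (λ n → q * (+ n ÷ 1)) (totalCount≡triangle X) ⟩
    q * (+ triangle X ÷ 1)
      ≤⟨ *-monoʳ-≤-nonNeg (+ triangle X ÷ 1) {{nonNegative (0≤a/b (triangle X) 1)}} q≤w ⟩
    w * (+ triangle X ÷ 1)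
      ≡⟨ /-* d n (triangle X) 1 ⟩
    + (d ℕ.* triangle X) ÷ (n ℕ.* 1)
      <⟨ cross-< (d ℕ.* triangle X) (n ℕ.* 1) (triangle (X / 2)) 1
        (subst₂ ℕ._<_ (sym (ℕ.*-identityʳ _)) (cong (triangle (X / 2) ℕ.*_) (sym (ℕ.*-identityʳ n)))
        (subst (d ℕ.* triangle X ℕ.<_) (ℕ.*-comm n (triangle (X / 2)))
        (d*triangle<4[1+d]*triangle[X/2] d X 2+d≤X))) ⟩
    + triangle (X / 2) ÷ 1
      ≤⟨ cross-≤ (triangle (X / 2)) 1 (posCount X) 1 (ℕ.*-monoˡ-≤ 1 (triangle[X/2]≤posCount X)) ⟩
    + posCount X ÷ 1 ∎
    where
    open ≤-Reasoning
    n = 4 ℕ.* suc d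
    w v : ℚ
    w = + d ÷ n
    v = + 1 ÷ n
    w+v≡¼ : w + v ≡ + 1 ÷ 4
    w+v≡¼ = trans (/-+ d 1 n) (cross-≡ (d ℕ.+ 1) n 1 4
        (solve 1 (λ d → (d :+ con 1) :* con 4 := con 1 :* (con 4 :* (con 1 :+ d))) refl d))
      where open ℕ-Solver.+-*-Solver
    q≤w : q ≤ w
    q≤w = begin
      q
        ≡⟨ solve 2 (λ a q → q := a :- (a :- q)) refl (+ 1 ÷ 4) q ⟩
      + 1 ÷ 4 - (+ 1 ÷ 4 - q)
        ≤⟨ +-monoʳ-≤ (+ 1 ÷ 4) (neg-antimono-≤ 1/[1+d]≤¼-q) ⟩
      + 1 ÷ 4 - + 1 ÷ suc d
        ≤⟨ +-monoʳ-≤ (+ 1 ÷ 4) (neg-antimono-≤ (cross-≤ 1 n 1 (suc d) (ℕ.*-monoʳ-≤ 1 (ℕ.m≤n*m (suc d) 4)))) ⟩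
      + 1 ÷ 4 - v
        ≡⟨ cong (_- v) w+v≡¼ ⟨
      w + v - v
        ≡⟨ solve 2 (λ w v → w :+ v :- v := w) refl w v ⟩
      w ∎
      where open ℚ-Solver.+-*-Solver

  posCount-density : (q : ℚ) → q < + 1 ÷ 4 →
    ∃ λ X₀ → (X : ℕ) → X₀ ℕ.≤ X → q * (+ totalCount X ÷ 1) < + posCount X ÷ 1
  posCount-density q q<¼ = map (2 ℕ.+_) (λ {d} → posCount-beats q d) (archimedean (Equivalence.from 0<q-p⇔p<q q<¼))

  q<1/18 : ∀ q → BelowInvTwoPiSq q → q < + 1 ÷ 18
  q<1/18 q (b , (K , leibniz<b) , 2qb²<1) with q <? + 1 ÷ 18
  ... | yes q<1/18 = q<1/18
  ... | no  q≮1/18 = contradiction (≤-<-trans 1≤2qb² 2qb²<1) (<-irrefl refl)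
    where
    1/18≤q : + 1 ÷ 18 ≤ q
    1/18≤q = ≮⇒≥ q≮1/18
    3≤b : ι (+ 3) ≤ b
    3≤b = <⇒≤ (≤-<-trans (3≤leibniz[1+2K] K) leibniz<b)
    0≤b : 0ℚ ≤ b
    0≤b = ≤-trans (0≤a/b 3 1) 3≤b
    1≤2qb² : 1ℚ ≤ ι (+ 2) * q * b * b
    1≤2qb² = begin
      1ℚ
        ≡⟨⟩
      ι (+ 2) * (+ 1 ÷ 18) * ι (+ 3) * ι (+ 3)
        ≤⟨ *-mono-≤-nonNeg (0≤a/b 6 18) 0≤b
          (*-mono-≤-nonNeg (0≤a/b 2 18) 0≤b
          (*-monoˡ-≤-nonNeg (ι (+ 2)) {{nonNegative (0≤a/b 2 1)}} 1/18≤q) 3≤b) 3≤b ⟩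
      ι (+ 2) * q * b * b ∎
      where open ≤-Reasoning

  negCount-beats : ∀ q → BelowInvTwoPiSq q → ∀ X → 1000 ℕ.≤ X → q * (+ totalCount X ÷ 1) < + negCount X ÷ 1
  negCount-beats q q<1/[2π²] X 1000≤X = begin-strict
    q * (+ totalCount X ÷ 1)
      ≡⟨ cong (λ n → q * (+ n ÷ 1)) (totalCount≡triangle X) ⟩
    q * (+ triangle X ÷ 1)
      <⟨ *-monoˡ-<-pos (+ triangle X ÷ 1) {{positive (0<a/b (triangle X) 1 {{triangle≢0}})}} (q<1/18 q q<1/[2π²]) ⟩
    + 1 ÷ 18 * (+ triangle X ÷ 1)
      ≡⟨ /-* 1 18 (triangle X) 1 ⟩
    + (1 ℕ.* triangle X) ÷ (18 ℕ.* 1)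
      ≤⟨ cross-≤ (1 ℕ.* triangle X) (18 ℕ.* 1) (negCount X) 1
        (ℕ.≤-trans (ℕ.≤-reflexive (trans (ℕ.*-identityʳ _) (ℕ.*-identityˡ _)))
        (ℕ.≤-trans (triangle≤18*negCount X 1000≤X) (ℕ.≤-reflexive (ℕ.*-comm 18 (negCount X))))) ⟩
    + negCount X ÷ 1 ∎
    where
    open ≤-Reasoning
    triangle≢0 : ℕ.NonZero (triangle X)
    triangle≢0 = ℕ.>-nonZero (ℕ.≤-trans (ℕ.≤-trans (ℕ.s≤s ℕ.z≤n) 1000≤X) (n≤triangle X))

  negCount-density : (q : ℚ) → BelowInvTwoPiSq q →
    ∃ λ X₀ → (X : ℕ) → X₀ ℕ.≤ X → q * (+ totalCount X ÷ 1) < + negCount X ÷ 1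
  negCount-density q q<1/[2π²] = 1000 , negCount-beats q q<1/[2π²]

open import Defs
open import Data.Nat as ℕ using (ℕ; suc; _^_)
open import Data.Nat.Divisibility using (_∣_)
open import Data.Nat.GCD using (gcd)
open import Data.Nat.Primality using (Prime)
open import Data.Integer as ℤ using (ℤ; +_; ∣_∣)
open import Data.Integer.Divisibility as ℤd using ()
open import Data.Rational using (ℚ; _/_; 0ℚ; _<_; _*_)
open import Data.Product using (_×_; ∃; _,_)
open import Data.Sum using (_⊎_)
open import Relation.Nullary using (¬_)
open import Relation.Binary.PropositionalEquality using (_≡_)
open import Function.Bundles using (_⇔_)
open SignOfBias using (0<bias[p^t]⇔; 6∣M⇒bias<0⇔)
open Densities using (posCount-density; negCount-density)

theorem3p2 : ((m : ℤ) (p t : ℕ) → Prime p → ¬ (2 ∣ p) → 1 ℕ.≤ t →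
    (0ℚ < bias m (p ^ t) ⇔ ((+ p) ℤd.∣ (m ℤ.- + 1) ⊎ (+ p) ℤd.∣ (m ℤ.+ + 1))))
    × ((m : ℤ) (M : ℕ) → 1 ℕ.< M → 6 ∣ M →
    (bias m M < 0ℚ ⇔ (gcd (∣ m ℤ.- + 1 ∣) M ≡ 1 ⊎ gcd (∣ m ℤ.+ + 1 ∣) M ≡ 1)))
    × ((q : ℚ) → q < + 1 / 4 →
    ∃ λ X₀ → (X : ℕ) → X₀ ℕ.≤ X → q * (+ totalCount X / 1) < + posCount X / 1)
    × ((q : ℚ) → BelowInvTwoPiSq q →
    ∃ λ X₀ → (X : ℕ) → X₀ ℕ.≤ X → q * (+ totalCount X / 1) < + negCount X / 1)
theorem3p2 = 0<bias[p^t]⇔ , 6∣M⇒bias<0⇔ , posCount-density , negCount-density
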